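{- Let $G$ be a finite simple graph that contains no 3-path configuration as an induced subgraph, and let $A$, $B$, $X$, $Y$, $Z$ be pairwise disjoint subsets of $V(G)$, each inducing a connected subgraph. If $X$, $Y$ and $Z$ are pairwise anticomplete, $A$ and $B$ are anticomplete to each other, and each of $A$ and $B$ sees each of $X$, $Y$ and $Z$, then $A$ and $B$ are both of type path with respect to $X$, $Y$ and $Z$.
   Context: A path means a chordless (induced) path, possibly a single vertex; lengths are numbers of edges. For disjoint vertex sets $S,T$: $S$ sees $T$ if some vertex of $S$ is adjacent to some vertex of $T$; $S$ is anticomplete to $T$ if no vertex of $S$ is adjacent to a vertex of $T$. $A$ is of type path centered at $Y$ (w.r.t. $X,Y,Z$) if there is a path $P=x\dots z$ in $G[A]$ such that $x$ sees $X$, $z$ sees $Z$, $P$ sees $Y$, $V(P)\setminus\{x\}$ is anticomplete to $X$ and $V(P)\setminus\{z\}$ is anticomplete to $Z$. Type path centered at $X$ or at $Z$ is defined symmetrically, and $A$ is of type path if it is of type path centered at one of $X,Y,Z$. A theta is a graph made of three internally vertex-disjoint chordless paths $P_1=a\dots b$, $P_2=a\dots b$, $P_3=a\dots b$, each of length at least two, with no edges between the paths except the three edges incident to $a$ and the three edges incident to $b$. A prism is a graph made of three vertex-disjoint chordless paths $P_1=a_1\dots b_1$, $P_2=a_2\dots b_2$, $P_3=a_3\dots b_3$ such that $\{a_1,a_2,a_3\}$ and $\{b_1,b_2,b_3\}$ are triangles, no edges exist between the paths except those of the two triangles, and either all three paths have length at least $1$, or one of them has length $0$ and each of the other two has length at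 least $2$. A pyramid is a graph made of three chordless paths $P_1=a\dots b_1$, $P_2=a\dots b_2$, $P_3=a\dots b_3$, each of length at least one and two of them of length at least two, vertex-disjoint except at $a$, such that $\{b_1,b_2,b_3\}$ is a triangle and no edges exist between the paths except those of the triangle and the three edges incident to $a$. A 3-path configuration (3PC) is a theta, a prism or a pyramid. -}

module Defs where

open import Data.Nat using (ℕ; zero; suc; _≤_)
open import Data.Fin using (Fin; zero; suc; toℕ; fromℕ)
open import Data.Fin.Subset using (Subset; _∈_; _∉_)
open import Data.Product using (Σ; ∃; ∃-syntax; _×_; _,_)
open import Data.Sum using (_⊎_)
open import Relation.Nullary using (¬_; Dec)
open import Relation.Binary.PropositionalEquality using (_≡_; _≢_)

record Graph : Set₁ where
  field
    n     : ℕ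
    E     : Fin n → Fin n → Set
    E-dec : ∀ u v → Dec (E u v)
    E-sym : ∀ {u v} → E u v → E v u
    E-irr : ∀ {u} → ¬ E u u

module _ (G : Graph) where
  open Graph G

  V : Set
  V = Fin n

  VSet : Set
  VSet = Subset n

  Disjoint : VSet → VSet → Set
  Disjoint S T = ∀ v → v ∈ S → v ∉ T

  Sees : VSet → VSet → Set
  Sees S T = ∃[ u ] ∃[ v ] (u ∈ S × v ∈ T × E u v)

  Anticomplete : VSet → VSet → Set
  Anticomplete S T = ∀ u v → u ∈ S → v ∈ T → ¬ E u v

  VSees : V → VSet → Set
  VSees u T = ∃[ v ] (v ∈ T × E u v)

  data WalkIn (S : VSet) : V → V → Set where
    here : ∀ {u} → u ∈ S → WalkIn S u u
    step : ∀ {u w v} → u ∈ S → E u w → WalkIn S w v → WalkIn S u v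

  Connected : VSet → Set
  Connected S = ∀ u v → u ∈ S → v ∈ S → WalkIn S u v

  IsPath : (k : ℕ) → (Fin (suc k) → V) → Set
  IsPath k p =
    (∀ i j → p i ≡ p j → i ≡ j) ×
    (∀ i j → (E (p i) (p j) → (suc (toℕ i) ≡ toℕ j ⊎ suc (toℕ j) ≡ toℕ i))
           × ((suc (toℕ i) ≡ toℕ j ⊎ suc (toℕ j) ≡ toℕ i) → E (p i) (p j)))

  lastIx : (k : ℕ) → Fin (suc k)
  lastIx k = fromℕ k

  TypePathCentered : VSet → VSet → VSet → VSet → Set
  TypePathCentered A X Y Z =
    ∃[ k ] Σ (Fin (suc k) → V) λ p →
      IsPath k p ×
      (∀ i → p i ∈ A) ×
      VSees (p zero) X ×
      VSees (p (lastIx k)) Z ×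
      (∃[ i ] VSees (p i) Y) ×
      (∀ i → i ≢ zero → ∀ v → v ∈ X → ¬ E (p i) v) ×
      (∀ i → i ≢ lastIx k → ∀ v → v ∈ Z → ¬ E (p i) v)

  TypePath : VSet → VSet → VSet → VSet → Set
  TypePath A X Y Z =
    TypePathCentered A X Y Z ⊎ TypePathCentered A Y X Z ⊎ TypePathCentered A X Z Y

  Interior : (k : ℕ) → Fin (suc k) → Set
  Interior k i = (1 ≤ toℕ i) × (suc (toℕ i) ≤ k)

  HasTheta : Set
  HasTheta =
    ∃[ a ] ∃[ b ] Σ (Fin 3 → ℕ) λ len → Σ ((t : Fin 3) → Fin (suc (len t)) → V) λ P →
      (∀ t → IsPath (len t) (P t)) ×
      (∀ t → 2 ≤ len t) ×
      (∀ t → P t zero ≡ a) × (∀ t → P t (lastIx (len t)) ≡ b) ×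
      (∀ s t → s ≢ t → ∀ i j → Interior (len s) i → Interior (len t) j → P s i ≢ P t j) ×
      (∀ s t → s ≢ t → ∀ i j → Interior (len s) i → Interior (len t) j → ¬ E (P s i) (P t j))

  HasPrism : Set
  HasPrism =
    Σ (Fin 3 → ℕ) λ len → Σ ((t : Fin 3) → Fin (suc (len t)) → V) λ P →
      (∀ t → IsPath (len t) (P t)) ×
      ((∀ t → 1 ≤ len t) ⊎ (∃[ s ] (len s ≡ 0 × (∀ t → t ≢ s → 2 ≤ len t)))) ×
      (∀ s t → s ≢ t → ∀ i j → P s i ≢ P t j) ×
      (∀ s t → s ≢ t → ∀ i j →
        (E (P s i) (P t j) →
           (i ≡ zero × j ≡ zero) ⊎ (i ≡ lastIx (len s) × j ≡ lastIx (len t))) ×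
        ((i ≡ zero × j ≡ zero) ⊎ (i ≡ lastIx (len s) × j ≡ lastIx (len t)) →
           E (P s i) (P t j)))

  HasPyramid : Set
  HasPyramid =
    ∃[ a ] Σ (Fin 3 → ℕ) λ len → Σ ((t : Fin 3) → Fin (suc (len t)) → V) λ P →
      (∀ t → IsPath (len t) (P t)) ×
      (∀ t → 1 ≤ len t) ×
      (∃[ s ] ∃[ t ] (s ≢ t × 2 ≤ len s × 2 ≤ len t)) ×
      (∀ t → P t zero ≡ a) ×
      (∀ s t → s ≢ t → ∀ i j → i ≢ zero → j ≢ zero → P s i ≢ P t j) ×
      (∀ s t → s ≢ t → ∀ i j → i ≢ zero → j ≢ zero →
        (E (P s i) (P t j) → i ≡ lastIx (len s) × j ≡ lastIx (len t)) ×
        (i ≡ lastIx (len s) × j ≡ lastIx (len t) → E (P s i) (P t j)))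

  Has3PC : Set
  Has3PC = HasTheta ⊎ HasPrism ⊎ HasPyramid

{-# OPTIONS --safe #-}
-- A connected set C meeting three vertex predicates N₀, N₁, N₂ contains one of two minimal
-- structures: a chordless path whose ends are its only N α- and N γ-vertices
-- and which meets the third predicate, or a spider, i.e. three chordless legs, joined at a common
-- centre (claw) or at a triangle, whose feet are the only N t-vertices of the whole spider.
-- For C = A and N t = "has a neighbour in the t-th of X, Y, Z" such a path witnesses type path.
-- A spider in A is refuted: extend each foot a t through its set to B; B together with these
-- extensions is connected and contains exactly one neighbour of each a t, so it contains a spider
-- whose feet are these neighbours. Joining the two spiders along the three foot-to-foot edges gives
-- a theta (two claws), a pyramid (claw and triangle) or a prism (two triangles).

module Submission where

open import Defs
open import Data.Empty using (⊥; ⊥-elim)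
open import Data.Unit using (⊤; tt)
open import Data.Product using (Σ; ∃; ∃₂; _×_; _,_; proj₁; proj₂)
open import Data.Sum using (_⊎_; inj₁; inj₂)
open import Data.List using (List; []; _∷_; _++_; [_]; reverse; length; lookup)
open import Data.List.Properties using (++-assoc; ∷-injectiveˡ; unfold-reverse; reverse-++; length-++; length-reverse)
open import Data.List.Membership.Propositional using (find; lose) renaming (_∈_ to _∈ₗ_)
open import Data.List.Membership.Propositional.Properties using (∈-++⁺ˡ; ∈-++⁺ʳ; ∈-++⁻; ∈-∃++; ∈-lookup)
open import Data.List.Relation.Unary.Any as Any using (Any; here; there; any?)
open import Data.List.Relation.Unary.Any.Properties
  using (reverse⁺; reverse⁻; lookup-index) renaming (++⁺ˡ to any-++⁺ˡ; ++⁺ʳ to any-++⁺ʳ)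
open import Data.List.Relation.Binary.Subset.Propositional using (_⊆_)
open import Data.List.Relation.Binary.Subset.Propositional.Properties using (Any-resp-⊆)
open import Data.Nat using (ℕ; suc; _≤_; s≤s; z≤n)
open import Data.Nat.Properties using (n≮n; suc-injective; ≤-trans; m≤n+m)
open import Data.Fin using (Fin; zero; suc; toℕ; fromℕ; _≟_)
open import Data.Fin.Subset using (_∈_)
open import Data.Fin.Subset.Properties using (_∈?_)
open import Data.Fin.Properties using (all?; ¬∀⟶∃¬; toℕ-fromℕ) renaming (any? to anyFin?)
open import Relation.Unary using (Decidable)
open import Relation.Nullary using (¬_; Dec; yes; no)
open import Relation.Nullary.Decidable using (from-yes; ¬?; _→-dec_; _⊎-dec_; _×-dec_)
open import Relation.Binary.PropositionalEquality using (_≡_; _≢_; refl; sym; trans; cong; subst; subst₂)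

pattern one = suc zero
pattern two = suc (suc zero)

module _ {A : Set} where

  lastOf : A → List A → A
  lastOf x []       = x
  lastOf x (y ∷ ys) = lastOf y ys

  lastOf-++ : ∀ x xs ys → lastOf x (xs ++ ys) ≡ lastOf (lastOf x xs) ys
  lastOf-++ x []       ys = refl
  lastOf-++ x (y ∷ xs) ys = lastOf-++ y xs ys

  lastOf-∈ : ∀ x xs → lastOf x xs ∈ₗ x ∷ xs
  lastOf-∈ x []       = here refl
  lastOf-∈ x (y ∷ ys) = there (lastOf-∈ y ys)

  lastOf-∈-tail : ∀ x xs → xs ≢ [] → lastOf x xs ∈ₗ xs
  lastOf-∈-tail x []       xs≢[] = ⊥-elim (xs≢[] refl)
  lastOf-∈-tail x (y ∷ ys) _     = lastOf-∈ y ys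

  lastOf-split : ∀ {x xs} pre z post → x ∷ xs ≡ pre ++ z ∷ post → lastOf x xs ≡ lastOf z post
  lastOf-split []        z post refl = refl
  lastOf-split (b ∷ pre) z post refl = lastOf-++ b pre (z ∷ post)

  reverse-∷ : ∀ x xs → ∃ λ ys → reverse (x ∷ xs) ≡ lastOf x xs ∷ ys × lastOf (lastOf x xs) ys ≡ x
  reverse-∷ x []       = [] , refl , refl
  reverse-∷ x (z ∷ zs) with reverse-∷ z zs
  ... | ys , eq , _ =
    ys ++ [ x ] , trans (unfold-reverse x (z ∷ zs)) (cong (_++ [ x ]) eq) , lastOf-++ (lastOf z zs) ys [ x ]

  reverse-∷-⊆ : ∀ {x : A} {xs ys} → reverse (x ∷ xs) ≡ ys → ys ⊆ x ∷ xs
  reverse-∷-⊆ refl = reverse⁻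

  reverse-∷-⊇ : ∀ {x : A} {xs ys} → reverse (x ∷ xs) ≡ ys → x ∷ xs ⊆ ys
  reverse-∷-⊇ refl = reverse⁺

  split-suffix-⊆ : ∀ {L : List A} pre y post → L ≡ pre ++ y ∷ post → y ∷ post ⊆ L
  split-suffix-⊆ pre y post refl = ∈-++⁺ʳ pre

  split-prefix-⊆ : ∀ {L : List A} pre y post → L ≡ pre ++ y ∷ post → y ∷ reverse pre ⊆ L
  split-prefix-⊆ pre y post refl (here refl) = ∈-++⁺ʳ pre (here refl)
  split-prefix-⊆ pre y post refl (there z∈)  = ∈-++⁺ˡ {xs = pre} (reverse⁻ z∈)

  ≟[] : (xs : List A) → Dec (xs ≡ [])
  ≟[] []      = yes refl
  ≟[] (_ ∷ _) = no λ ()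

  lastOf-reversed-prefix : ∀ {x xs} pre y post → x ∷ xs ≡ pre ++ y ∷ post → lastOf y (reverse pre) ≡ x
  lastOf-reversed-prefix []        y post refl = refl
  lastOf-reversed-prefix (b ∷ pre) y post refl =
    trans (cong (lastOf y) (unfold-reverse b pre)) (lastOf-++ y (reverse pre) [ b ])

  None : (A → Set) → List A → Set
  None Q L = ∀ w → w ∈ₗ L → ¬ Q w

  Split : (A → Set) → List A → Set
  Split Q L = ∃ λ pre → ∃₂ λ z post → L ≡ pre ++ z ∷ post × Q z

  module _ {Q : A → Set} (Q? : Decidable Q) where

    firstSplit : ∀ L → Any Q L → Σ (Split Q L) λ s → None Q (proj₁ s)
    firstSplit (x ∷ L) q with Q? x
    ... | yes qx = ([] , x , L , refl , qx) , λ w ()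
    ... | no ¬qx with firstSplit L (Any.tail ¬qx q)
    ...   | (pre , z , post , eq , qz) , none =
      (x ∷ pre , z , post , cong (x ∷_) eq , qz) ,
      λ { w (here refl) → ¬qx ; w (there w∈) → none w w∈ }

    lastSplit : ∀ L → Any Q L → Σ (Split Q L) λ s → None Q (proj₁ (proj₂ (proj₂ s)))
    lastSplit (x ∷ L) q with any? Q? L
    ... | yes qL with lastSplit L qL
    ...   | (pre , z , post , eq , qz) , none = (x ∷ pre , z , post , cong (x ∷_) eq , qz) , none
    lastSplit (x ∷ L) (here qx)  | no ¬qL = ([] , x , L , refl , qx) , λ w w∈ qw → ¬qL (lose w∈ qw)
    lastSplit (x ∷ L) (there qL) | no ¬qL = ⊥-elim (¬qL qL)

  MeetsAll : (Fin 3 → A → Set) → List A → Set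
  MeetsAll N L = ∀ t → Any (N t) L

  shortestSuffix : {N : Fin 3 → A → Set} → (∀ t → Decidable (N t)) → ∀ L → MeetsAll N L →
    ∃ λ α → ∃ λ pre → ∃₂ λ x xs → L ≡ pre ++ x ∷ xs × MeetsAll N (x ∷ xs) × ¬ Any (N α) xs
  shortestSuffix N? [] meets with meets zero
  ... | ()
  shortestSuffix N? (x ∷ xs) meets with all? (λ t → any? (N? t) xs)
  ... | yes meets′ with shortestSuffix N? xs meets′
  ...   | α , pre , y , ys , eq , m , ¬α = α , x ∷ pre , y , ys , cong (x ∷_) eq , m , ¬α
  shortestSuffix N? (x ∷ xs) meets | no ¬meets′ with ¬∀⟶∃¬ 3 _ (λ t → any? (N? t) xs) ¬meets′
  ... | α , ¬α = α , [] , x , xs , refl , meets , ¬α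

cases₃ : {P : Fin 3 → Set} → P zero → P one → P two → ∀ t → P t
cases₃ p₀ p₁ p₂ zero = p₀
cases₃ p₀ p₁ p₂ one  = p₁
cases₃ p₀ p₁ p₂ two  = p₂

onDistinctPairs : (R : Fin 3 → Fin 3 → Set) → (∀ {s t} → R s t → R t s) →
  R zero one → R zero two → R one two → ∀ s t → s ≢ t → R s t
onDistinctPairs R R-sym r01 r02 r12 = λ where
  zero zero s≢t → ⊥-elim (s≢t refl)
  zero one  _   → r01
  zero two  _   → r02
  one  zero _   → R-sym r01
  one  one  s≢t → ⊥-elim (s≢t refl)
  one  two  _   → r12
  two  zero _   → R-sym r02
  two  one  _   → R-sym r12
  two  two  s≢t → ⊥-elim (s≢t refl)

third : Fin 3 → Fin 3 → Fin 3
third zero one  = two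
third one  zero = two
third zero two  = one
third two  zero = one
third _    _    = zero

third-unique : ∀ α γ t → α ≢ γ → t ≢ α → t ≢ γ → t ≡ third α γ
third-unique = from-yes (all? λ α → all? λ γ → all? λ t →
  ¬? (α ≟ γ) →-dec ¬? (t ≟ α) →-dec ¬? (t ≟ γ) →-dec t ≟ third α γ)

data Role (α γ t : Fin 3) : Set where
  isα : t ≡ α → Role α γ t
  isγ : t ≡ γ → Role α γ t
  isβ : t ≡ third α γ → Role α γ t

role : ∀ α γ → α ≢ γ → ∀ t → Role α γ t
role α γ α≢γ t with t ≟ α | t ≟ γ
... | yes t≡α | _       = isα t≡α
... | no  _   | yes t≡γ = isγ t≡γ
... | no  t≢α | no  t≢γ = isβ (third-unique α γ t α≢γ t≢α t≢γ)

module _ (G : Graph) where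
  open Graph G

  Vertex : Set
  Vertex = V G

  Apart : Vertex → Vertex → Set
  Apart u v = u ≢ v × ¬ E u v

  Apart-sym : ∀ {u v} → Apart u v → Apart v u
  Apart-sym (u≢v , ¬uv) = (λ v≡u → u≢v (sym v≡u)) , (λ vu → ¬uv (E-sym vu))

  Leads : Vertex → List Vertex → Set
  Leads x []       = ⊤
  Leads x (y ∷ ys) = E x y × (∀ z → z ∈ₗ ys → Apart x z)

  Chordless : List Vertex → Set
  Chordless []       = ⊤
  Chordless (x ∷ xs) = Leads x xs × Chordless xs

  Walk : Vertex → List Vertex → Set
  Walk x []       = ⊤
  Walk x (y ∷ ys) = E x y × Walk y ys

  chordless⇒walk : ∀ x xs → Chordless (x ∷ xs) → Walk x xs
  chordless⇒walk x []       _               = tt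
  chordless⇒walk x (y ∷ ys) ((xy , _) , cs) = xy , chordless⇒walk y ys cs

  chordless-head-∉ : ∀ x xs → Chordless (x ∷ xs) → ∀ z → z ∈ₗ xs → x ≢ z
  chordless-head-∉ x (y ∷ ys) ((xy , _) , _) z (here refl) refl = E-irr xy
  chordless-head-∉ x (y ∷ ys) ((_ , apart) , _) z (there z∈) = proj₁ (apart z z∈)

  chordless-head-neighbour : ∀ x y ys → Chordless (x ∷ y ∷ ys) → ∀ z → z ∈ₗ y ∷ ys → E x z → z ≡ y
  chordless-head-neighbour x y ys _                  z (here z≡y) _  = z≡y
  chordless-head-neighbour x y ys ((_ , apart) , _) z (there z∈)  xz = ⊥-elim (proj₂ (apart z z∈) xz)

  chordless-trivial : ∀ y ys → Chordless (y ∷ ys) → lastOf y ys ≡ y → ys ≡ []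
  chordless-trivial y []       _ _    = refl
  chordless-trivial y (w ∷ ws) c last≡y =
    ⊥-elim (chordless-head-∉ y (w ∷ ws) c (lastOf w ws) (lastOf-∈ w ws) (sym last≡y))

  chordless-suffix : ∀ xs ys → Chordless (xs ++ ys) → Chordless ys
  chordless-suffix []       ys c        = c
  chordless-suffix (x ∷ xs) ys (_ , c) = chordless-suffix xs ys c

  chordless-prefix : ∀ xs ys → Chordless (xs ++ ys) → Chordless xs
  chordless-prefix []           ys _                  = tt
  chordless-prefix (x ∷ [])     ys _                  = tt , tt
  chordless-prefix (x ∷ y ∷ zs) ys ((xy , apart) , c) =
    (xy , λ z z∈ → apart z (∈-++⁺ˡ z∈)) , chordless-prefix (y ∷ zs) ys c

  chordless-++-disjoint : ∀ xs ys → Chordless (xs ++ ys) → ∀ u v → u ∈ₗ xs → v ∈ₗ ys → u ≢ v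
  chordless-++-disjoint (x ∷ xs) ys c       u v (here refl) v∈ = chordless-head-∉ x (xs ++ ys) c v (∈-++⁺ʳ xs v∈)
  chordless-++-disjoint (x ∷ xs) ys (_ , c) u v (there u∈)  v∈ = chordless-++-disjoint xs ys c u v u∈ v∈

  chordless-++-edge : ∀ x xs y ys → Chordless (x ∷ xs ++ y ∷ ys) →
    ∀ u v → u ∈ₗ x ∷ xs → v ∈ₗ y ∷ ys → E u v → u ≡ lastOf x xs × v ≡ y
  chordless-++-edge x [] y ys c u v (here refl) v∈ uv = refl , chordless-head-neighbour x y ys c v v∈ uv
  chordless-++-edge x (x′ ∷ xs) y ys c u v (here refl) v∈ uv =
    ⊥-elim (chordless-++-disjoint (x′ ∷ xs) (y ∷ ys) (proj₂ c) x′ v (here refl) v∈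
      (sym (chordless-head-neighbour x x′ (xs ++ y ∷ ys) c v (there (∈-++⁺ʳ xs v∈)) uv)))
  chordless-++-edge x (x′ ∷ xs) y ys (_ , c) u v (there u∈) v∈ uv = chordless-++-edge x′ xs y ys c u v u∈ v∈ uv

  chordless-junction : ∀ x xs y ys → Chordless (x ∷ xs ++ y ∷ ys) → E (lastOf x xs) y
  chordless-junction x []        y ys ((xy , _) , _) = xy
  chordless-junction x (x′ ∷ xs) y ys (_ , c)        = chordless-junction x′ xs y ys c

  chordless-apart : ∀ xs m ys → Chordless (xs ++ m ∷ ys) → ∀ u v → u ∈ₗ xs → v ∈ₗ ys → Apart u v
  chordless-apart (x ∷ xs) m ys c u v u∈ v∈ =
    chordless-++-disjoint (x ∷ xs) (m ∷ ys) c u v u∈ (there v∈) ,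
    λ uv → chordless-head-∉ m ys (chordless-suffix (x ∷ xs) (m ∷ ys) c) v v∈
             (sym (proj₂ (chordless-++-edge x xs m ys c u v u∈ (there v∈) uv)))

  JoinedOnlyAt : List Vertex → List Vertex → Vertex → Vertex → Set
  JoinedOnlyAt xs ys u v = ∀ x y → x ∈ₗ xs → y ∈ₗ ys → x ≢ y × (E x y → x ≡ u × y ≡ v)

  JoinedOnlyAt-sym : ∀ {xs ys u v} → JoinedOnlyAt xs ys u v → JoinedOnlyAt ys xs v u
  JoinedOnlyAt-sym joined y x y∈ x∈ with joined x y x∈ y∈
  ... | x≢y , only = (λ y≡x → x≢y (sym y≡x)) , (λ yx → let x≡ , y≡ = only (E-sym yx) in y≡ , x≡)

  ApartLists : List Vertex → List Vertex → Set
  ApartLists xs ys = ∀ x y → x ∈ₗ xs → y ∈ₗ ys → Apart x y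

  ApartLists-sym : ∀ {xs ys} → ApartLists xs ys → ApartLists ys xs
  ApartLists-sym apart y x y∈ x∈ = Apart-sym (apart x y x∈ y∈)

  chordless-++ : ∀ x xs y ys → Chordless (x ∷ xs) → Chordless (y ∷ ys) → E (lastOf x xs) y →
    JoinedOnlyAt (x ∷ xs) (y ∷ ys) (lastOf x xs) y → Chordless (x ∷ xs ++ y ∷ ys)
  chordless-++ x [] y ys _ cy xy joined = (xy , apart) , cy
    where
    apart : ∀ z → z ∈ₗ ys → Apart x z
    apart z z∈ = proj₁ (joined x z (here refl) (there z∈)) ,
      λ xz → chordless-head-∉ y ys cy z z∈ (sym (proj₂ (proj₂ (joined x z (here refl) (there z∈)) xz)))
  chordless-++ x (x′ ∷ xs) y ys cx@((xx′ , apartx) , cx′) cy xy joined =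
    (xx′ , apart) , chordless-++ x′ xs y ys cx′ cy xy (λ u v u∈ → joined u v (there u∈))
    where
    apart : ∀ z → z ∈ₗ xs ++ y ∷ ys → Apart x z
    apart z z∈ with ∈-++⁻ xs z∈
    ... | inj₁ z∈xs = apartx z z∈xs
    ... | inj₂ z∈ys = proj₁ (joined x z (here refl) z∈ys) ,
      λ xz → chordless-head-∉ x (x′ ∷ xs) cx (lastOf x′ xs) (lastOf-∈ x′ xs)
               (proj₁ (proj₂ (joined x z (here refl) z∈ys) xz))

  chordless-reverse : ∀ xs → Chordless xs → Chordless (reverse xs)
  chordless-reverse []           _ = tt
  chordless-reverse (x ∷ [])     _ = tt , tt
  chordless-reverse (x ∷ y ∷ ys) c@(_ , cy) with reverse-∷ y ys | chordless-reverse (y ∷ ys) cy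
  ... | zs , rev≡ , last≡y | crev =
    subst Chordless (sym (trans (unfold-reverse x (y ∷ ys)) (cong (_++ [ x ]) rev≡)))
      (chordless-++ z zs x [] (subst Chordless rev≡ crev) (tt , tt)
        (subst (λ w → E w x) (sym last≡y) (E-sym (proj₁ (proj₁ c)))) joined)
    where
    z : Vertex
    z = lastOf y ys
    joined : JoinedOnlyAt (z ∷ zs) [ x ] (lastOf z zs) x
    joined u v u∈ (here refl) =
      (λ u≡x → chordless-head-∉ x (y ∷ ys) c u (reverse-∷-⊆ rev≡ u∈) (sym u≡x)) ,
      λ ux → trans (chordless-head-neighbour x y ys c u (reverse-∷-⊆ rev≡ u∈) (E-sym ux)) (sym last≡y) , refl

  chordless-reversed-prefix : ∀ pre y post → Chordless (pre ++ y ∷ post) → Chordless (y ∷ reverse pre)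
  chordless-reversed-prefix pre y post c =
    subst Chordless (reverse-++ pre [ y ])
      (chordless-reverse (pre ++ [ y ])
        (chordless-prefix (pre ++ [ y ]) post (subst Chordless (sym (++-assoc pre [ y ] post)) c)))

  chordless-glue : ∀ xs y ys → Chordless (xs ++ [ y ]) → Chordless (y ∷ ys) → ApartLists xs ys →
    Chordless (xs ++ y ∷ ys)
  chordless-glue []            y ys _ cy _ = cy
  chordless-glue (x ∷ [])      y ys ((xy , _) , _) cy apart =
    (xy , λ z z∈ → apart x z (here refl) z∈) , cy
  chordless-glue (x ∷ x′ ∷ xs) y ys ((xx′ , apartx) , c) cy apart =
    (xx′ , apart′) , chordless-glue (x′ ∷ xs) y ys c cy (λ u v u∈ → apart u v (there u∈))
    where
    apart′ : ∀ z → z ∈ₗ xs ++ y ∷ ys → Apart x z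
    apart′ z z∈ with ∈-++⁻ xs z∈
    ... | inj₁ z∈xs        = apartx z (∈-++⁺ˡ z∈xs)
    ... | inj₂ (here refl) = apartx z (∈-++⁺ʳ xs (here refl))
    ... | inj₂ (there z∈ys) = apart x z (here refl) z∈ys

  chordless-through : ∀ c xs ys → Chordless (c ∷ xs) → Chordless (c ∷ ys) → ApartLists xs ys →
    Chordless (reverse xs ++ c ∷ ys)
  chordless-through c xs ys cxs cys apart =
    chordless-glue (reverse xs) c ys (subst Chordless (unfold-reverse c xs) (chordless-reverse (c ∷ xs) cxs)) cys
      (λ u v u∈ → apart u v (reverse⁻ u∈))

  data WalkWithin (C : Vertex → Set) : Vertex → Vertex → Set where
    stay : ∀ {u} → C u → WalkWithin C u u
    step : ∀ {u w v} → C u → E u w → WalkWithin C w v → WalkWithin C u v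

  ConnectedWithin : (Vertex → Set) → Set
  ConnectedWithin C = ∀ u v → C u → C v → WalkWithin C u v

  module _ {C : Vertex → Set} where

    walkWithin-start : ∀ {u v} → WalkWithin C u v → C u
    walkWithin-start (stay cu)     = cu
    walkWithin-start (step cu _ _) = cu

    walkWithin-++ : ∀ {u w v} → WalkWithin C u w → WalkWithin C w v → WalkWithin C u v
    walkWithin-++ (stay _)         q = q
    walkWithin-++ (step cu uw p) q = step cu uw (walkWithin-++ p q)

    walkWithin-reverse : ∀ {u v} → WalkWithin C u v → WalkWithin C v u
    walkWithin-reverse (stay cu)      = stay cu
    walkWithin-reverse (step cu uw p) =
      walkWithin-++ (walkWithin-reverse p) (step (walkWithin-start p) (E-sym uw) (stay cu))

    walk⇒walkWithin : ∀ x xs → Walk x xs → (∀ z → z ∈ₗ x ∷ xs → C z) → WalkWithin C x (lastOf x xs)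
    walk⇒walkWithin x []       _         within = stay (within x (here refl))
    walk⇒walkWithin x (y ∷ ys) (xy , w) within =
      step (within x (here refl)) xy (walk⇒walkWithin y ys w (λ z z∈ → within z (there z∈)))

    walkWithin⇒walk : ∀ {u v} → WalkWithin C u v →
      ∃ λ ws → Walk u ws × lastOf u ws ≡ v × (∀ z → z ∈ₗ u ∷ ws → C z)
    walkWithin⇒walk (stay cu) = [] , tt , refl , λ { z (here refl) → cu }
    walkWithin⇒walk (step {w = w} cu uw p) with walkWithin⇒walk p
    ... | ws , walk , last≡ , within =
      w ∷ ws , (uw , walk) , last≡ , λ { z (here refl) → cu ; z (there z∈) → within z z∈ }

  walkWithin-mono : ∀ {C D : Vertex → Set} {u v} → (∀ z → C z → D z) → WalkWithin C u v → WalkWithin D u v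
  walkWithin-mono f (stay cu)      = stay (f _ cu)
  walkWithin-mono f (step cu uw p) = step (f _ cu) uw (walkWithin-mono f p)

  fromWalkIn : ∀ {S u v} → WalkIn G S u v → WalkWithin (_∈ S) u v
  fromWalkIn (WalkIn.here u∈)         = stay u∈
  fromWalkIn (WalkIn.step u∈ uw rest) = step u∈ uw (fromWalkIn rest)

  ClosedNeighbour : Vertex → Vertex → Set
  ClosedNeighbour x z = z ≡ x ⊎ E x z

  walk⇒chordless : ∀ x xs → Walk x xs →
    ∃ λ ps → Chordless (x ∷ ps) × lastOf x ps ≡ lastOf x xs × x ∷ ps ⊆ x ∷ xs
  walk⇒chordless x []       _        = [] , (tt , tt) , refl , λ z∈ → z∈
  walk⇒chordless x (y ∷ ys) (xy , w) with walk⇒chordless y ys w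
  ... | ps , c , last≡ , ps⊆
      with lastSplit (λ z → (z ≟ x) ⊎-dec E-dec x z) (y ∷ ps) (here (inj₂ xy))
  ... | (pre , z , post , eq , near) , far = shortcut near
    where
    cpost : Chordless (z ∷ post)
    cpost = chordless-suffix pre (z ∷ post) (subst Chordless eq c)
    lastz : lastOf z post ≡ lastOf y ys
    lastz = trans (sym (lastOf-split pre z post eq)) last≡
    post⊆ : z ∷ post ⊆ x ∷ y ∷ ys
    post⊆ z∈ = there (ps⊆ (subst (_ ∈ₗ_) (sym eq) (∈-++⁺ʳ pre z∈)))
    apart : ∀ w → w ∈ₗ post → Apart x w
    apart w w∈ = (λ x≡w → far w w∈ (inj₁ (sym x≡w))) , (λ xw → far w w∈ (inj₂ xw))
    -- z is the last vertex of y ∷ ps in the closed neighbourhood of x, so the path jumps from x to z.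
    shortcut : ClosedNeighbour x z →
      ∃ λ qs → Chordless (x ∷ qs) × lastOf x qs ≡ lastOf y ys × x ∷ qs ⊆ x ∷ y ∷ ys
    shortcut (inj₁ z≡x) = post , subst (λ v → Chordless (v ∷ post)) z≡x cpost ,
      subst (λ v → lastOf v post ≡ _) z≡x lastz , subst (λ v → v ∷ post ⊆ _) z≡x post⊆
    shortcut (inj₂ xz)  = z ∷ post , ((xz , apart) , cpost) , lastz ,
      λ { (here refl) → here refl ; (there w∈) → post⊆ w∈ }

  walkWithin⇒chordless : ∀ {C u v} → WalkWithin C u v →
    ∃ λ ps → Chordless (u ∷ ps) × lastOf u ps ≡ v × (∀ z → z ∈ₗ u ∷ ps → C z)
  walkWithin⇒chordless {u = u} p with walkWithin⇒walk p
  ... | ws , walk , last≡ , within with walk⇒chordless u ws walk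
  ... | ps , c , last≡′ , ps⊆ = ps , c , trans last≡′ last≡ , λ z z∈ → within z (ps⊆ z∈)

  record PathBetween (P Q : Vertex → Set) : Set where
    constructor pathBetween
    field
      start     : Vertex
      rest      : List Vertex
      chordless : Chordless (start ∷ rest)
      start-P   : P start
      end-Q     : Q (lastOf start rest)
      P⇒start   : ∀ z → z ∈ₗ start ∷ rest → P z → z ≡ start
      Q⇒end     : ∀ z → z ∈ₗ start ∷ rest → Q z → z ≡ lastOf start rest

    vertices : List Vertex
    vertices = start ∷ rest

  trim : ∀ {P Q} → Decidable P → Decidable Q → ∀ x xs → Chordless (x ∷ xs) → P x → Q (lastOf x xs) →
    Σ (PathBetween P Q) λ p → PathBetween.vertices p ⊆ x ∷ xs
  trim {P} {Q} P? Q? x xs c px q-last with lastSplit P? (x ∷ xs) (here px)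
  ... | (pre , z , post , eq , pz) , noP with Q? z
  ... | yes qz = pathBetween z [] (tt , tt) pz qz only-z only-z , z∈
    where
    only-z : ∀ {R : Vertex → Set} v → v ∈ₗ [ z ] → R v → v ≡ z
    only-z v (here v≡z) _ = v≡z
    z∈ : [ z ] ⊆ x ∷ xs
    z∈ (here refl) = subst (z ∈ₗ_) (sym eq) (∈-++⁺ʳ pre (here refl))
  ... | no ¬qz
      with firstSplit Q? post (Any.tail ¬qz (lose (lastOf-∈ z post) (subst Q (lastOf-split pre z post eq) q-last)))
  ... | (mid , w , post′ , eq′ , qw) , noQ =
    pathBetween z (mid ++ [ w ]) chordless pz (subst Q (sym (lastOf-++ z mid [ w ])) qw) P-only Q-only , within
    where
    z∷post≡ : z ∷ post ≡ (z ∷ mid ++ [ w ]) ++ post′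
    z∷post≡ = cong (z ∷_) (trans eq′ (sym (++-assoc mid [ w ] post′)))
    in-post : z ∷ mid ++ [ w ] ⊆ z ∷ post
    in-post {v} v∈ = subst (v ∈ₗ_) (sym z∷post≡) (∈-++⁺ˡ v∈)
    chordless : Chordless (z ∷ mid ++ [ w ])
    chordless = chordless-prefix (z ∷ mid ++ [ w ]) post′
      (subst Chordless z∷post≡ (chordless-suffix pre (z ∷ post) (subst Chordless eq c)))
    P-only : ∀ v → v ∈ₗ z ∷ mid ++ [ w ] → P v → v ≡ z
    P-only v v∈ pv with in-post v∈
    ... | here v≡z    = v≡z
    ... | there v∈post = ⊥-elim (noP v v∈post pv)
    Q-only : ∀ v → v ∈ₗ z ∷ mid ++ [ w ] → Q v → v ≡ lastOf z (mid ++ [ w ])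
    Q-only v (here refl) qv = ⊥-elim (¬qz qv)
    Q-only v (there v∈) qv with ∈-++⁻ mid v∈
    ... | inj₁ v∈mid       = ⊥-elim (noQ v v∈mid qv)
    ... | inj₂ (here refl) = sym (lastOf-++ z mid [ w ])
    within : z ∷ mid ++ [ w ] ⊆ x ∷ xs
    within {v} v∈ = subst (v ∈ₗ_) (sym eq) (∈-++⁺ʳ pre (in-post v∈))

  reversePath : ∀ {P Q} (p : PathBetween P Q) → Σ (PathBetween Q P) λ q →
    PathBetween.vertices q ⊆ PathBetween.vertices p × PathBetween.vertices p ⊆ PathBetween.vertices q
  reversePath {P} {Q} (pathBetween x xs c px qe P⇒x Q⇒e) with reverse-∷ x xs
  ... | ys , rev≡ , last≡x =
    pathBetween (lastOf x xs) ys (subst Chordless rev≡ (chordless-reverse (x ∷ xs) c)) qe (subst P (sym last≡x) px)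
      (λ z z∈ qz → Q⇒e z (reverse-∷-⊆ rev≡ z∈) qz)
      (λ z z∈ pz → trans (P⇒x z (reverse-∷-⊆ rev≡ z∈) pz) (sym last≡x)) ,
    reverse-∷-⊆ rev≡ , reverse-∷-⊇ rev≡

  record ThreadedPath (C : Vertex → Set) (N : Fin 3 → Vertex → Set) : Set where
    constructor threaded
    field
      α γ     : Fin 3
      α≢γ     : α ≢ γ
      path    : PathBetween (N α) (N γ)
      within  : ∀ z → z ∈ₗ PathBetween.vertices path → C z
      through : Any (N (third α γ)) (PathBetween.vertices path)

  module Threading {C : Vertex → Set} {N : Fin 3 → Vertex → Set} (N? : ∀ t → Decidable (N t)) where

    shortestChordlessSuffix : ∀ l ls → Chordless (l ∷ ls) → MeetsAll N (l ∷ ls) →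
      ∃ λ α → ∃₂ λ x xs → Chordless (x ∷ xs) × x ∷ xs ⊆ l ∷ ls × lastOf x xs ≡ lastOf l ls ×
        MeetsAll N (x ∷ xs) × N α x × (∀ z → z ∈ₗ x ∷ xs → N α z → z ≡ x)
    shortestChordlessSuffix l ls c meets with shortestSuffix N? (l ∷ ls) meets
    ... | α , pre , x , xs , eq , meets′ , ¬α =
      α , x , xs , chordless-suffix pre (x ∷ xs) (subst Chordless eq c) ,
      (λ {z} z∈ → subst (z ∈ₗ_) (sym eq) (∈-++⁺ʳ pre z∈)) , sym (lastOf-split pre x xs eq) ,
      meets′ , head-N (meets′ α) , only-x
      where
      head-N : Any (N α) (x ∷ xs) → N α x
      head-N (here nx)   = nx
      head-N (there nxs) = ⊥-elim (¬α nxs)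
      only-x : ∀ z → z ∈ₗ x ∷ xs → N α z → z ≡ x
      only-x z (here z≡x) _  = z≡x
      only-x z (there z∈) nz = ⊥-elim (¬α (lose z∈ nz))

    singleVertex : ∀ {v} → C v → (∀ t → N t v) → ThreadedPath C N
    singleVertex {v} cv nv =
      threaded zero two (λ ()) (pathBetween v [] (tt , tt) (nv _) (nv _) only-v only-v)
        (λ { z (here refl) → cv }) (here (nv _))
      where
      only-v : ∀ {R : Vertex → Set} z → z ∈ₗ [ v ] → R z → z ≡ v
      only-v z (here z≡v) _ = z≡v

    -- Trim from the front, then from the back; the two trimmed ends are the unique vertices of
    -- their predicates, and if both predicates coincide the path is a single vertex meeting all three.
    threadedSubpath : ∀ L → Chordless L → (∀ z → z ∈ₗ L → C z) → MeetsAll N L → ThreadedPath C N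
    threadedSubpath [] _ _ meets with meets zero
    ... | ()
    threadedSubpath (l ∷ ls) c within meets with shortestChordlessSuffix l ls c meets
    ... | α , x , xs , cx , x⊆ , _ , meetsx , nx , only-x with reverse-∷ x xs
    ... | ys , rev≡ , last≡x
        with shortestChordlessSuffix (lastOf x xs) ys (subst Chordless rev≡ (chordless-reverse (x ∷ xs) cx))
               (λ t → Any-resp-⊆ (reverse-∷-⊇ rev≡) (meetsx t))
    ... | γ , y′ , ys′ , cy′ , y′⊆ , last≡ , meetsy′ , ny′ , only-y′ = finish (α ≟ γ)
      where
      in-x : y′ ∷ ys′ ⊆ x ∷ xs
      in-x z∈ = reverse-∷-⊆ rev≡ (y′⊆ z∈)
      within′ : ∀ z → z ∈ₗ y′ ∷ ys′ → C z
      within′ z z∈ = within z (x⊆ (in-x z∈))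
      end≡x : lastOf y′ ys′ ≡ x
      end≡x = trans last≡ last≡x
      finish : Dec (α ≡ γ) → ThreadedPath C N
      finish (yes refl) = singleVertex (within′ y′ (here refl)) all-N
        where
        y′≡x : y′ ≡ x
        y′≡x = only-x y′ (in-x (here refl)) ny′
        all-N : ∀ t → N t y′
        all-N t with meetsy′ t | chordless-trivial y′ ys′ cy′ (trans end≡x (sym y′≡x))
        ... | here n | _  = n
        ... | there () | refl
      finish (no α≢γ) with reversePath (pathBetween y′ ys′ cy′ ny′ (subst (N α) (sym end≡x) nx) only-y′
                                          (λ z z∈ nz → trans (only-x z (in-x z∈) nz) (sym end≡x)))
      ... | p , p⊆ , ⊆p = threaded α γ α≢γ p (λ z z∈ → within′ z (p⊆ z∈)) (Any-resp-⊆ ⊆p (meetsy′ _))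

  IsClaw : (Fin 3 → Vertex) → (Fin 3 → List Vertex) → Set
  IsClaw head tail = (∀ s t → head s ≡ head t) × (∀ s t → s ≢ t → ApartLists (tail s) (tail t))

  IsTriangle : (Fin 3 → Vertex) → (Fin 3 → List Vertex) → Set
  IsTriangle head tail = (∀ s t → s ≢ t → E (head s) (head t)) ×
    (∀ s t → s ≢ t → JoinedOnlyAt (head s ∷ tail s) (head t ∷ tail t) (head s) (head t))

  record Legs : Set where
    constructor legs
    field
      head      : Fin 3 → Vertex
      tail      : Fin 3 → List Vertex
      chordless : ∀ t → Chordless (head t ∷ tail t)
      shape     : IsClaw head tail ⊎ IsTriangle head tail

    leg : Fin 3 → List Vertex
    leg t = head t ∷ tail t

    foot : Fin 3 → Vertex
    foot t = lastOf (head t) (tail t)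

  record Spider (C : Vertex → Set) (N : Fin 3 → Vertex → Set) : Set where
    constructor spider
    field
      body   : Legs
    open Legs body public
    field
      within : ∀ t z → z ∈ₗ leg t → C z
      foot-N : ∀ t → N t (foot t)
      N⇒foot : ∀ t s z → z ∈ₗ leg s → N t z → z ≡ foot t

  ProperSpider : (Vertex → Set) → (Fin 3 → Vertex → Set) → Set
  ProperSpider C N = Σ (Spider C N) λ S → IsClaw (Spider.head S) (Spider.tail S) → ∀ t → Spider.tail S t ≢ []

  Tripod : (Vertex → Set) → (Fin 3 → Vertex → Set) → Set
  Tripod C N = ThreadedPath C N ⊎ ProperSpider C N

  module _ {C : Vertex → Set} {N : Fin 3 → Vertex → Set} (N? : ∀ t → Decidable (N t)) where
    open Threading {C} {N} N?

    -- The centre of a claw whose leg t is empty is the foot of t, so the other two legs form a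
    -- path meeting all three predicates.
    clawPath : (S : Spider C N) → IsClaw (Spider.head S) (Spider.tail S) → ∀ s t u → s ≢ u →
      Spider.tail S t ≡ [] → (∀ i → i ≡ s ⊎ i ≡ t ⊎ i ≡ u) → ThreadedPath C N
    clawPath S (same , apart) s t u s≢u tail≡[] cover = threadedSubpath L chordless′ within′ meets
      where
      open Spider S
      L : List Vertex
      L = reverse (tail s) ++ head s ∷ tail u
      chordless′ : Chordless L
      chordless′ = chordless-through (head s) (tail s) (tail u) (chordless s)
        (subst (λ h → Chordless (h ∷ tail u)) (same u s) (chordless u)) (apart s u s≢u)
      leg-s⊆ : leg s ⊆ L
      leg-s⊆ (here refl) = ∈-++⁺ʳ (reverse (tail s)) (here refl)
      leg-s⊆ (there z∈)  = ∈-++⁺ˡ (reverse⁺ z∈)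
      leg-u⊆ : leg u ⊆ L
      leg-u⊆ (here refl) = ∈-++⁺ʳ (reverse (tail s)) (here (same u s))
      leg-u⊆ (there z∈)  = ∈-++⁺ʳ (reverse (tail s)) (there z∈)
      within′ : ∀ z → z ∈ₗ L → C z
      within′ z z∈ with ∈-++⁻ (reverse (tail s)) z∈
      ... | inj₁ z∈s         = within s z (there (reverse⁻ z∈s))
      ... | inj₂ (here refl) = within s z (here refl)
      ... | inj₂ (there z∈u) = within u z (there z∈u)
      meets : MeetsAll N L
      meets i with cover i
      ... | inj₁ refl        = Any-resp-⊆ leg-s⊆ (lose (lastOf-∈ (head s) (tail s)) (foot-N s))
      ... | inj₂ (inj₁ refl) = Any-resp-⊆ leg-s⊆ (lose (here (same t s))
                                 (subst (λ l → N t (lastOf (head t) l)) tail≡[] (foot-N t)))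
      ... | inj₂ (inj₂ refl) = Any-resp-⊆ leg-u⊆ (lose (lastOf-∈ (head u) (tail u)) (foot-N u))

    spider⇒tripod : Spider C N → Tripod C N
    spider⇒tripod S with Spider.shape S
    ... | inj₂ (adjacent , _) =
      inj₂ (S , λ (same , _) → ⊥-elim (E-irr (subst (E _) (same one zero) (adjacent zero one (λ ())))))
    ... | inj₁ claw with ≟[] (Spider.tail S zero) | ≟[] (Spider.tail S one) | ≟[] (Spider.tail S two)
    ... | yes e | _     | _     = inj₁ (clawPath S claw one zero two (λ ()) e
                                    λ { zero → inj₂ (inj₁ refl) ; one → inj₁ refl ; two → inj₂ (inj₂ refl) })
    ... | no _  | yes e | _     = inj₁ (clawPath S claw zero one two (λ ()) e
                                    λ { zero → inj₁ refl ; one → inj₂ (inj₁ refl) ; two → inj₂ (inj₂ refl) })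
    ... | no _  | no _  | yes e = inj₁ (clawPath S claw zero two one (λ ()) e
                                    λ { zero → inj₁ refl ; one → inj₂ (inj₂ refl) ; two → inj₂ (inj₁ refl) })
    ... | no ¬e₀ | no ¬e₁ | no ¬e₂ = inj₂ (S , λ _ → λ { zero → ¬e₀ ; one → ¬e₁ ; two → ¬e₂ })

  SeesList : List Vertex → Vertex → Set
  SeesList L v = Any (E v) L

  module ThirdBranch {C : Vertex → Set} {N : Fin 3 → Vertex → Set} (N? : ∀ t → Decidable (N t))
    (P : PathBetween (N zero) (N two)) (P-within : ∀ z → z ∈ₗ PathBetween.vertices P → C z)
    (P-no-N₁ : None (N one) (PathBetween.vertices P))
    (R : PathBetween (N one) (SeesList (PathBetween.vertices P)))
    (R-within : ∀ z → z ∈ₗ PathBetween.vertices R → C z)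
    (R-disjoint : ∀ u v → u ∈ₗ PathBetween.vertices R → v ∈ₗ PathBetween.vertices P → u ≢ v)
    where
    open Threading {C} {N} N?
    open PathBetween P using () renaming
      (start to p; rest to P′; chordless to P-chordless; start-P to p-N₀; end-Q to end-N₂;
       P⇒start to N₀⇒p; Q⇒end to N₂⇒end)
    open PathBetween R using () renaming
      (start to r; rest to R′; chordless to R-chordless; start-P to r-N₁; end-Q to rl-sees;
       P⇒start to N₁⇒r; Q⇒end to sees⇒rl)

    Pl Rl : List Vertex
    Pl = p ∷ P′
    Rl = r ∷ R′

    rl pl : Vertex
    rl = lastOf r R′
    pl = lastOf p P′

    edge⇒rl : ∀ u v → u ∈ₗ Rl → v ∈ₗ Pl → E u v → u ≡ rl
    edge⇒rl u v u∈ v∈ uv = sees⇒rl u u∈ (lose v∈ uv)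

    R₁ : List Vertex
    R₁ = proj₁ (reverse-∷ r R′)

    R₁⊆ : rl ∷ R₁ ⊆ Rl
    R₁⊆ = reverse-∷-⊆ (proj₁ (proj₂ (reverse-∷ r R′)))

    R₁-chordless : Chordless (rl ∷ R₁)
    R₁-chordless = subst Chordless (proj₁ (proj₂ (reverse-∷ r R′))) (chordless-reverse Rl R-chordless)

    R₁-last : lastOf rl R₁ ≡ r
    R₁-last = proj₂ (proj₂ (reverse-∷ r R′))

    R-apart-P : ∀ x y → x ∈ₗ Pl → y ∈ₗ Rl → ¬ E rl x → Apart x y
    R-apart-P x y x∈ y∈ ¬rlx =
      (λ x≡y → R-disjoint y x y∈ x∈ (sym x≡y)) ,
      (λ xy → ¬rlx (subst (λ w → E w x) (edge⇒rl y x y∈ x∈ (E-sym xy)) (E-sym xy)))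

    R₁-apart-P : ∀ x y → x ∈ₗ Pl → y ∈ₗ R₁ → Apart x y
    R₁-apart-P x y x∈ y∈ =
      (λ x≡y → R-disjoint y x (R₁⊆ (there y∈)) x∈ (sym x≡y)) ,
      (λ xy → chordless-head-∉ rl R₁ R₁-chordless y y∈ (sym (edge⇒rl y x (R₁⊆ (there y∈)) x∈ (E-sym xy))))

    joinedToP : ∀ {L} → L ⊆ Rl → ∀ y ys → y ∷ ys ⊆ Pl → None (E rl) ys → JoinedOnlyAt L (y ∷ ys) rl y
    joinedToP L⊆ y ys ⊆P far u v u∈ v∈ =
      (λ u≡v → R-disjoint u v (L⊆ u∈) (⊆P v∈) u≡v) ,
      λ uv → let u≡rl = edge⇒rl u v (L⊆ u∈) (⊆P v∈) uv in u≡rl , only-y v v∈ (subst (λ w → E w v) u≡rl uv)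
      where
      only-y : ∀ v → v ∈ₗ y ∷ ys → E rl v → v ≡ y
      only-y v (here v≡y) _  = v≡y
      only-y v (there v∈) rlv = ⊥-elim (far v v∈ rlv)

    within-PR : ∀ z → z ∈ₗ Pl ++ Rl → C z
    within-PR z z∈ with ∈-++⁻ Pl z∈
    ... | inj₁ z∈P = P-within z z∈P
    ... | inj₂ z∈R = R-within z z∈R

    pathAlongP : ∀ y ys → Chordless (y ∷ ys) → y ∷ ys ⊆ Pl → E rl y → None (E rl) ys →
      MeetsAll N (Rl ++ y ∷ ys) → Tripod C N
    pathAlongP y ys cy ⊆P rly far meets =
      inj₁ (threadedSubpath (Rl ++ y ∷ ys)
              (chordless-++ r R′ y ys R-chordless cy rly (joinedToP (λ u∈ → u∈) y ys ⊆P far)) within meets)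
      where
      within : ∀ z → z ∈ₗ Rl ++ y ∷ ys → C z
      within z z∈ with ∈-++⁻ Rl z∈
      ... | inj₁ z∈R = R-within z z∈R
      ... | inj₂ z∈y = P-within z (⊆P z∈y)

    spiderOnPR : (L : Legs) → (∀ t → Legs.leg L t ⊆ Pl ++ Rl) →
      Legs.foot L zero ≡ p → Legs.foot L one ≡ r → Legs.foot L two ≡ pl →
      None (N zero) Rl → None (N two) Rl → Tripod C N
    spiderOnPR L ⊆PR f₀ f₁ f₂ R-no-N₀ R-no-N₂ =
      spider⇒tripod N? (spider L (λ t z z∈ → within-PR z (⊆PR t z∈)) foot-N N⇒foot)
      where
      open Legs L
      foot-N : ∀ t → N t (foot t)
      foot-N zero = subst (N zero) (sym f₀) p-N₀
      foot-N one  = subst (N one) (sym f₁) r-N₁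
      foot-N two  = subst (N two) (sym f₂) end-N₂
      N⇒foot′ : ∀ t z → z ∈ₗ Pl ⊎ z ∈ₗ Rl → N t z → z ≡ foot t
      N⇒foot′ zero z (inj₁ z∈P) nz = trans (N₀⇒p z z∈P nz) (sym f₀)
      N⇒foot′ zero z (inj₂ z∈R) nz = ⊥-elim (R-no-N₀ z z∈R nz)
      N⇒foot′ one  z (inj₁ z∈P) nz = ⊥-elim (P-no-N₁ z z∈P nz)
      N⇒foot′ one  z (inj₂ z∈R) nz = trans (N₁⇒r z z∈R nz) (sym f₁)
      N⇒foot′ two  z (inj₁ z∈P) nz = trans (N₂⇒end z z∈P nz) (sym f₂)
      N⇒foot′ two  z (inj₂ z∈R) nz = ⊥-elim (R-no-N₂ z z∈R nz)
      N⇒foot : ∀ t s z → z ∈ₗ leg s → N t z → z ≡ foot t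
      N⇒foot t s z z∈ = N⇒foot′ t z (∈-++⁻ Pl (⊆PR s z∈))

    clawAtNeighbour : ∀ P₁ pa Pr → Pl ≡ P₁ ++ pa ∷ Pr → E rl pa → None (E rl) P₁ → None (E rl) Pr →
      None (N zero) Rl → None (N two) Rl → Tripod C N
    clawAtNeighbour P₁ pa Pr eq rla far₁ farᵣ =
      spiderOnPR (legs (λ _ → pa) tail chordless
                   (inj₁ ((λ _ _ → refl) , onDistinctPairs (λ s t → ApartLists (tail s) (tail t)) ApartLists-sym
                                             apart₀₁ apart₀₂ apart₁₂)))
        ⊆PR (lastOf-reversed-prefix P₁ pa Pr eq) R₁-last (sym (lastOf-split P₁ pa Pr eq))
      where
      cP : Chordless (P₁ ++ pa ∷ Pr)
      cP = subst Chordless eq P-chordless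
      a⊆ : pa ∷ reverse P₁ ⊆ Pl
      a⊆ = split-prefix-⊆ P₁ pa Pr eq
      r⊆ : pa ∷ Pr ⊆ Pl
      r⊆ = split-suffix-⊆ P₁ pa Pr eq
      tail : Fin 3 → List Vertex
      tail = cases₃ (reverse P₁) (rl ∷ R₁) Pr
      chordless : ∀ t → Chordless (pa ∷ tail t)
      chordless zero = chordless-reversed-prefix P₁ pa Pr cP
      chordless one  = (E-sym rla , λ z z∈ → R₁-apart-P pa z (r⊆ (here refl)) z∈) , R₁-chordless
      chordless two  = chordless-suffix P₁ (pa ∷ Pr) cP
      apart₀₁ : ApartLists (reverse P₁) (rl ∷ R₁)
      apart₀₁ x y x∈ y∈ = R-apart-P x y (a⊆ (there x∈)) (R₁⊆ y∈) (far₁ x (reverse⁻ x∈))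
      apart₀₂ : ApartLists (reverse P₁) Pr
      apart₀₂ x y x∈ y∈ = chordless-apart P₁ pa Pr cP x y (reverse⁻ x∈) y∈
      apart₁₂ : ApartLists (rl ∷ R₁) Pr
      apart₁₂ x y x∈ y∈ = Apart-sym (R-apart-P y x (r⊆ (there y∈)) (R₁⊆ x∈) (farᵣ y y∈))
      ⊆PR : ∀ t → pa ∷ tail t ⊆ Pl ++ Rl
      ⊆PR zero z∈          = ∈-++⁺ˡ (a⊆ z∈)
      ⊆PR one  (here refl) = ∈-++⁺ˡ (r⊆ (here refl))
      ⊆PR one  (there z∈)  = ∈-++⁺ʳ Pl (R₁⊆ z∈)
      ⊆PR two  z∈          = ∈-++⁺ˡ (r⊆ z∈)

    triangle : ∀ P₁ pa pb P₄ → Pl ≡ P₁ ++ pa ∷ pb ∷ P₄ → E rl pa → E rl pb → None (E rl) P₁ → None (E rl) P₄ →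
      None (N zero) Rl → None (N two) Rl → Tripod C N
    triangle P₁ pa pb P₄ eq rla rlb far₁ far₄ =
      spiderOnPR (legs head tail chordless
                   (inj₂ (onDistinctPairs (λ s t → E (head s) (head t)) E-sym (E-sym rla) pa-pb rlb ,
                          onDistinctPairs (λ s t → JoinedOnlyAt (head s ∷ tail s) (head t ∷ tail t) (head s) (head t))
                            JoinedOnlyAt-sym joined₀₁ joined₀₂ joined₁₂)))
        ⊆PR (lastOf-reversed-prefix P₁ pa (pb ∷ P₄) eq) R₁-last (sym (lastOf-split (P₁ ++ [ pa ]) pb P₄ eq′))
      where
      cP : Chordless (P₁ ++ pa ∷ pb ∷ P₄)
      cP = subst Chordless eq P-chordless
      cab : Chordless (pa ∷ pb ∷ P₄)
      cab = chordless-suffix P₁ (pa ∷ pb ∷ P₄) cP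
      pa-pb : E pa pb
      pa-pb = proj₁ (proj₁ cab)
      eq′ : Pl ≡ (P₁ ++ [ pa ]) ++ pb ∷ P₄
      eq′ = trans eq (sym (++-assoc P₁ [ pa ] (pb ∷ P₄)))
      a⊆ : pa ∷ reverse P₁ ⊆ Pl
      a⊆ = split-prefix-⊆ P₁ pa (pb ∷ P₄) eq
      b⊆ : pb ∷ P₄ ⊆ Pl
      b⊆ = split-suffix-⊆ (P₁ ++ [ pa ]) pb P₄ eq′
      head : Fin 3 → Vertex
      head = cases₃ pa rl pb
      tail : Fin 3 → List Vertex
      tail = cases₃ (reverse P₁) R₁ P₄
      chordless : ∀ t → Chordless (head t ∷ tail t)
      chordless zero = chordless-reversed-prefix P₁ pa (pb ∷ P₄) cP
      chordless one  = R₁-chordless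
      chordless two  = proj₂ cab
      joined₀₁ : JoinedOnlyAt (pa ∷ reverse P₁) (rl ∷ R₁) pa rl
      joined₀₁ = JoinedOnlyAt-sym (joinedToP R₁⊆ pa (reverse P₁) a⊆ (λ v v∈ → far₁ v (reverse⁻ v∈)))
      joined₀₂ : JoinedOnlyAt (pa ∷ reverse P₁) (pb ∷ P₄) pa pb
      joined₀₂ x y (here refl) y∈ =
        chordless-head-∉ pa (pb ∷ P₄) cab y y∈ , λ xy → refl , chordless-head-neighbour pa pb P₄ cab y y∈ xy
      joined₀₂ x y (there x∈)  y∈ with chordless-apart P₁ pa (pb ∷ P₄) cP x y (reverse⁻ x∈) y∈
      ... | x≢y , ¬xy = x≢y , λ xy → ⊥-elim (¬xy xy)
      joined₁₂ : JoinedOnlyAt (rl ∷ R₁) (pb ∷ P₄) rl pb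
      joined₁₂ = joinedToP R₁⊆ pb P₄ b⊆ far₄
      ⊆PR : ∀ t → head t ∷ tail t ⊆ Pl ++ Rl
      ⊆PR zero z∈ = ∈-++⁺ˡ (a⊆ z∈)
      ⊆PR one  z∈ = ∈-++⁺ʳ Pl (R₁⊆ z∈)
      ⊆PR two  z∈ = ∈-++⁺ˡ (b⊆ z∈)

    clawAtEnd : ∀ P₁ pa m Mm pb P₄ → Pl ≡ P₁ ++ pa ∷ m ∷ Mm ++ pb ∷ P₄ → E rl pa → E rl pb →
      None (E rl) P₁ → None (E rl) P₄ → None (N zero) Rl → None (N two) Rl → Tripod C N
    clawAtEnd P₁ pa m Mm pb P₄ eq rla rlb far₁ far₄ =
      spiderOnPR (legs (λ _ → rl) tail chordless
                   (inj₁ ((λ _ _ → refl) , onDistinctPairs (λ s t → ApartLists (tail s) (tail t)) ApartLists-sym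
                                             apart₀₁ apart₀₂ apart₁₂)))
        ⊆PR (lastOf-reversed-prefix P₁ pa (m ∷ Mm ++ pb ∷ P₄) eq) R₁-last
        (sym (lastOf-split (P₁ ++ pa ∷ m ∷ Mm) pb P₄ eq′))
      where
      eq′ : Pl ≡ (P₁ ++ pa ∷ m ∷ Mm) ++ pb ∷ P₄
      eq′ = trans eq (sym (++-assoc P₁ (pa ∷ m ∷ Mm) (pb ∷ P₄)))
      eqₘ : Pl ≡ (P₁ ++ [ pa ]) ++ m ∷ Mm ++ pb ∷ P₄
      eqₘ = trans eq (sym (++-assoc P₁ [ pa ] (m ∷ Mm ++ pb ∷ P₄)))
      a⊆ : pa ∷ reverse P₁ ⊆ Pl
      a⊆ = split-prefix-⊆ P₁ pa (m ∷ Mm ++ pb ∷ P₄) eq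
      b⊆ : pb ∷ P₄ ⊆ Pl
      b⊆ = split-suffix-⊆ (P₁ ++ pa ∷ m ∷ Mm) pb P₄ eq′
      rl⊆ : [ rl ] ⊆ Rl
      rl⊆ (here refl) = R₁⊆ (here refl)
      tail : Fin 3 → List Vertex
      tail = cases₃ (pa ∷ reverse P₁) R₁ (pb ∷ P₄)
      chordless : ∀ t → Chordless (rl ∷ tail t)
      chordless zero = chordless-++ rl [] pa (reverse P₁) (tt , tt)
        (chordless-reversed-prefix P₁ pa (m ∷ Mm ++ pb ∷ P₄) (subst Chordless eq P-chordless)) rla
        (joinedToP rl⊆ pa (reverse P₁) a⊆ (λ v v∈ → far₁ v (reverse⁻ v∈)))
      chordless one  = R₁-chordless
      chordless two  = chordless-++ rl [] pb P₄ (tt , tt)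
        (chordless-suffix (P₁ ++ pa ∷ m ∷ Mm) (pb ∷ P₄) (subst Chordless eq′ P-chordless)) rlb
        (joinedToP rl⊆ pb P₄ b⊆ far₄)
      apart₀₁ : ApartLists (pa ∷ reverse P₁) R₁
      apart₀₁ x y x∈ y∈ = R₁-apart-P x y (a⊆ x∈) y∈
      -- the vertex m of P separates the two neighbours pa and pb of rl
      apart₀₂ : ApartLists (pa ∷ reverse P₁) (pb ∷ P₄)
      apart₀₂ x y x∈ y∈ = chordless-apart (P₁ ++ [ pa ]) m (Mm ++ pb ∷ P₄) (subst Chordless eqₘ P-chordless) x y
        (split-prefix-⊆ P₁ pa [] refl x∈) (∈-++⁺ʳ Mm y∈)
      apart₁₂ : ApartLists R₁ (pb ∷ P₄)
      apart₁₂ x y x∈ y∈ = Apart-sym (R₁-apart-P y x (b⊆ y∈) x∈)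
      ⊆PR : ∀ t → rl ∷ tail t ⊆ Pl ++ Rl
      ⊆PR t    (here refl) = ∈-++⁺ʳ Pl (R₁⊆ (here refl))
      ⊆PR zero (there z∈)  = ∈-++⁺ˡ (a⊆ z∈)
      ⊆PR one  (there z∈)  = ∈-++⁺ʳ Pl (R₁⊆ (there z∈))
      ⊆PR two  (there z∈)  = ∈-++⁺ˡ (b⊆ z∈)

    neighbourCases : ∀ P₁ pa Pr → Pl ≡ P₁ ++ pa ∷ Pr → E rl pa → None (E rl) P₁ →
      ∀ M pb P₄ → pa ∷ Pr ≡ M ++ pb ∷ P₄ → E rl pb → None (E rl) P₄ →
      None (N zero) Rl → None (N two) Rl → Tripod C N
    neighbourCases P₁ pa Pr eq rla far₁ []            pb P₄ refl rlb far₄ = clawAtNeighbour P₁ pa P₄ eq rla far₁ far₄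
    neighbourCases P₁ pa Pr eq rla far₁ (_ ∷ [])      pb P₄ refl rlb far₄ = triangle P₁ pa pb P₄ eq rla rlb far₁ far₄
    neighbourCases P₁ pa Pr eq rla far₁ (_ ∷ m ∷ Mm) pb P₄ refl rlb far₄ = clawAtEnd P₁ pa m Mm pb P₄ eq rla rlb far₁ far₄

    result : Tripod C N
    result with firstSplit (E-dec rl) Pl rl-sees
    ... | (P₁ , pa , Pr , eqa , rla) , far₁ with lastSplit (E-dec rl) (pa ∷ Pr) (here rla)
    ... | (M , pb , P₄ , eqb , rlb) , far₄ with any? (N? zero) Rl | any? (N? two) Rl
    ... | yes R-N₀ | _ =
      pathAlongP pb P₄ (chordless-suffix (P₁ ++ M) (pb ∷ P₄) (subst Chordless eq P-chordless))
        (split-suffix-⊆ (P₁ ++ M) pb P₄ eq) rlb far₄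
        (cases₃ (any-++⁺ˡ R-N₀) (here r-N₁)
          (any-++⁺ʳ Rl (lose (lastOf-∈ pb P₄) (subst (N two) (lastOf-split (P₁ ++ M) pb P₄ eq) end-N₂))))
      where
      eq : Pl ≡ (P₁ ++ M) ++ pb ∷ P₄
      eq = trans eqa (trans (cong (P₁ ++_) eqb) (sym (++-assoc P₁ M (pb ∷ P₄))))
    ... | no _ | yes R-N₂ =
      pathAlongP pa (reverse P₁) (chordless-reversed-prefix P₁ pa Pr (subst Chordless eqa P-chordless))
        (split-prefix-⊆ P₁ pa Pr eqa) rla (λ v v∈ → far₁ v (reverse⁻ v∈))
        (cases₃ (any-++⁺ʳ Rl (lose (lastOf-∈ pa (reverse P₁))
                                  (subst (N zero) (sym (lastOf-reversed-prefix P₁ pa Pr eqa)) p-N₀)))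
          (here r-N₁) (any-++⁺ˡ R-N₂))
    ... | no ¬R-N₀ | no ¬R-N₂ =
      neighbourCases P₁ pa Pr eqa rla far₁ M pb P₄ eqb rlb far₄
        (λ z z∈ nz → ¬R-N₀ (lose z∈ nz)) (λ z z∈ nz → ¬R-N₂ (lose z∈ nz))

  module _ {C : Vertex → Set} {N : Fin 3 → Vertex → Set} (N? : ∀ t → Decidable (N t))
           (connected : ConnectedWithin C) (meets : ∀ t → ∃ λ u → C u × N t u) where
    open Threading {C} {N} N?

    -- Walk from an N₁-vertex to P and keep the part before P, from its last N₁-vertex on.
    tripodFrom : (P : PathBetween (N zero) (N two)) → (∀ z → z ∈ₗ PathBetween.vertices P → C z) → Tripod C N
    tripodFrom P@(pathBetween p P′ cP p-N₀ end-N₂ _ _) P-within with any? (N? one) (p ∷ P′)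
    ... | yes P-N₁ =
      inj₁ (threadedSubpath (p ∷ P′) cP P-within (cases₃ (here p-N₀) P-N₁ (lose (lastOf-∈ p P′) end-N₂)))
    ... | no ¬P-N₁ with meets one
    ... | u , cu , nu with walkWithin⇒chordless (connected u p cu (P-within p (here refl)))
    ... | qs , cqs , last≡ , q-within
        with firstSplit (λ v → any? (v ≟_) (p ∷ P′)) (u ∷ qs)
               (lose (subst (_∈ₗ u ∷ qs) last≡ (lastOf-∈ u qs)) (here refl))
    ... | ([] , z , post , eq , z∈P) , _ = ⊥-elim (¬P-N₁ (lose z∈P (subst (N one) (∷-injectiveˡ eq) nu)))
    ... | (a ∷ pre , z , post , eq , z∈P) , outside
        with trim (N? one) (λ v → any? (E-dec v) (p ∷ P′)) a pre
               (chordless-prefix (a ∷ pre) (z ∷ post) (subst Chordless eq cqs))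
               (subst (N one) (∷-injectiveˡ eq) nu) (lose z∈P (chordless-junction a pre z post (subst Chordless eq cqs)))
    ... | R , R⊆ =
      ThirdBranch.result N? P P-within (λ w w∈ nw → ¬P-N₁ (lose w∈ nw)) R
        (λ w w∈ → q-within w (subst (w ∈ₗ_) (sym eq) (∈-++⁺ˡ (R⊆ w∈))))
        (λ x y x∈ y∈ x≡y → outside x (R⊆ x∈) (subst (_∈ₗ p ∷ P′) (sym x≡y) y∈))

    opaque
      tripod : Tripod C N
      tripod with meets zero | meets two
      ... | u₀ , c₀ , n₀ | u₂ , c₂ , n₂ with walkWithin⇒chordless (connected u₀ u₂ c₀ c₂)
      ... | ps , cps , last≡ , within with trim (N? zero) (N? two) u₀ ps cps n₀ (subst (N two) (sym last≡) n₂)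
      ... | P , P⊆ = tripodFrom P (λ z z∈ → within z (P⊆ z∈))

  Consecutive : ∀ {k} → Fin k → Fin k → Set
  Consecutive i j = suc (toℕ i) ≡ toℕ j ⊎ suc (toℕ j) ≡ toℕ i

  consecutive-sym : ∀ {k} {i j : Fin k} → Consecutive i j → Consecutive j i
  consecutive-sym (inj₁ e) = inj₂ e
  consecutive-sym (inj₂ e) = inj₁ e

  consecutive-suc : ∀ {k} {i j : Fin k} → Consecutive i j → Consecutive (suc i) (suc j)
  consecutive-suc (inj₁ e) = inj₁ (cong suc e)
  consecutive-suc (inj₂ e) = inj₂ (cong suc e)

  consecutive-suc⁻ : ∀ {k} {i j : Fin k} → Consecutive (suc i) (suc j) → Consecutive i j
  consecutive-suc⁻ (inj₁ e) = inj₁ (suc-injective e)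
  consecutive-suc⁻ (inj₂ e) = inj₂ (suc-injective e)

  lookup-injective : ∀ L → Chordless L → ∀ i j → lookup L i ≡ lookup L j → i ≡ j
  lookup-injective (x ∷ xs) c       zero    zero    _ = refl
  lookup-injective (x ∷ xs) c       zero    (suc j) e = ⊥-elim (chordless-head-∉ x xs c (lookup xs j) (∈-lookup j) e)
  lookup-injective (x ∷ xs) c       (suc i) zero    e = ⊥-elim (chordless-head-∉ x xs c (lookup xs i) (∈-lookup i) (sym e))
  lookup-injective (x ∷ xs) (_ , c) (suc i) (suc j) e = cong suc (lookup-injective xs c i j e)

  head-edge⇒consecutive : ∀ x xs → Chordless (x ∷ xs) → ∀ j → E x (lookup (x ∷ xs) j) →
    Consecutive {suc (length xs)} zero j
  head-edge⇒consecutive x xs       _               zero          xx = ⊥-elim (E-irr xx)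
  head-edge⇒consecutive x (y ∷ ys) _               (suc zero)    _  = inj₁ refl
  head-edge⇒consecutive x (y ∷ ys) ((_ , apart) , _) (suc (suc j)) xz =
    ⊥-elim (proj₂ (apart (lookup ys j) (∈-lookup j)) xz)

  edge⇒consecutive : ∀ L → Chordless L → ∀ i j → E (lookup L i) (lookup L j) → Consecutive i j
  edge⇒consecutive (x ∷ xs) c       zero    j       e = head-edge⇒consecutive x xs c j e
  edge⇒consecutive (x ∷ xs) c       (suc i) zero    e = consecutive-sym (head-edge⇒consecutive x xs c (suc i) (E-sym e))
  edge⇒consecutive (x ∷ xs) (_ , c) (suc i) (suc j) e = consecutive-suc (edge⇒consecutive xs c i j e)

  consecutive⇒head-edge : ∀ x xs → Chordless (x ∷ xs) → ∀ j → Consecutive {suc (length xs)} zero j →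
    E x (lookup (x ∷ xs) j)
  consecutive⇒head-edge x xs       _               zero          (inj₁ ())
  consecutive⇒head-edge x xs       _               zero          (inj₂ ())
  consecutive⇒head-edge x (y ∷ ys) ((xy , _) , _) (suc zero)    _ = xy
  consecutive⇒head-edge x (y ∷ ys) _               (suc (suc j)) (inj₁ ())
  consecutive⇒head-edge x (y ∷ ys) _               (suc (suc j)) (inj₂ ())

  consecutive⇒edge : ∀ L → Chordless L → ∀ i j → Consecutive i j → E (lookup L i) (lookup L j)
  consecutive⇒edge (x ∷ xs) c       zero    j       ij = consecutive⇒head-edge x xs c j ij
  consecutive⇒edge (x ∷ xs) c       (suc i) zero    ij = E-sym (consecutive⇒head-edge x xs c (suc i) (consecutive-sym ij))
  consecutive⇒edge (x ∷ xs) (_ , c) (suc i) (suc j) ij = consecutive⇒edge xs c i j (consecutive-suc⁻ ij)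

  lookup-last : ∀ (x : Vertex) xs → lookup (x ∷ xs) (fromℕ (length xs)) ≡ lastOf x xs
  lookup-last x []       = refl
  lookup-last x (y ∷ ys) = lookup-last y ys

  chordless⇒IsPath : ∀ x xs → Chordless (x ∷ xs) → IsPath G (length xs) (lookup (x ∷ xs))
  chordless⇒IsPath x xs c =
    lookup-injective (x ∷ xs) c , λ i j → edge⇒consecutive (x ∷ xs) c i j , consecutive⇒edge (x ∷ xs) c i j

  interior≢zero : ∀ {k} (i : Fin (suc k)) → Interior G k i → i ≢ zero
  interior≢zero zero (() , _) refl

  interior≢last : ∀ {k} (i : Fin (suc k)) → Interior G k i → i ≢ fromℕ k
  interior≢last {k} i (_ , i<k) refl = n≮n k (subst (λ m → suc m ≤ k) (toℕ-fromℕ k) i<k)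

  module _ (L : Legs) where
    open Legs L

    FeetSeparated : Set
    FeetSeparated = ∀ t r u → u ∈ₗ leg t → u ≡ foot r → r ≡ t

    triangle⇒feetSeparated : IsTriangle head tail → FeetSeparated
    triangle⇒feetSeparated (_ , joined) t r u u∈ u≡foot with r ≟ t
    ... | yes r≡t = r≡t
    ... | no  r≢t = ⊥-elim (proj₁ (joined r t r≢t (foot r) u (lastOf-∈ (head r) (tail r)) u∈) (sym u≡foot))

    claw-foot∉tail : IsClaw head tail → ∀ s t → s ≢ t → foot s ∈ₗ tail t → ⊥
    claw-foot∉tail (same , apart) s t s≢t foot∈ with ≟[] (tail s)
    ... | yes tail≡[] = chordless-head-∉ (head t) (tail t) (chordless t) (foot s) foot∈
                          (trans (same t s) (sym (cong (lastOf (head s)) tail≡[])))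
    ... | no  tail≢[] = proj₁ (apart s t s≢t (foot s) (foot s) (lastOf-∈-tail (head s) (tail s) tail≢[]) foot∈) refl

    claw⇒feetSeparated : IsClaw head tail → (∀ t → tail t ≢ []) → FeetSeparated
    claw⇒feetSeparated claw@(same , _) nonempty t r u u∈ u≡foot with r ≟ t | u∈
    ... | yes r≡t | _            = r≡t
    ... | no  _   | here u≡head  = ⊥-elim (chordless-head-∉ (head r) (tail r) (chordless r) (foot r)
                                     (lastOf-∈-tail (head r) (tail r) (nonempty r))
                                     (trans (same r t) (trans (sym u≡head) u≡foot)))
    ... | no  r≢t | there u∈tail = ⊥-elim (claw-foot∉tail claw r t r≢t (subst (_∈ₗ tail t) u≡foot u∈tail))

  -- Route t runs along leg t of the first spider and back along leg t of the second; the three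
  -- routes form a theta, a pyramid or a prism according to the shapes of the two spiders.
  module Glue (L₁ L₂ : Legs)
    (disjoint : ∀ s t x y → x ∈ₗ Legs.leg L₁ s → y ∈ₗ Legs.leg L₂ t → x ≢ y)
    (edge : ∀ s t x y → x ∈ₗ Legs.leg L₁ s → y ∈ₗ Legs.leg L₂ t → E x y →
            ∃ λ r → x ≡ Legs.foot L₁ r × y ≡ Legs.foot L₂ r)
    (attached : ∀ t → E (Legs.foot L₁ t) (Legs.foot L₂ t))
    (separated : FeetSeparated L₁ ⊎ FeetSeparated L₂)
    where
    open Legs L₁ using () renaming (head to h₁; tail to t₁; leg to leg₁; foot to f₁; chordless to c₁)
    open Legs L₂ using () renaming (head to h₂; tail to t₂; leg to leg₂; foot to f₂; chordless to c₂)

    route : Fin 3 → List Vertex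
    route t = t₁ t ++ reverse (leg₂ t)

    len : Fin 3 → ℕ
    len t = length (route t)

    vertexAt : (t : Fin 3) → Fin (suc (len t)) → Vertex
    vertexAt t = lookup (h₁ t ∷ route t)

    edge-same-leg : ∀ t u v → u ∈ₗ leg₁ t → v ∈ₗ leg₂ t → E u v → u ≡ f₁ t × v ≡ f₂ t
    edge-same-leg t u v u∈ v∈ uv with edge t t u v u∈ v∈ uv
    ... | r , u≡ , v≡ = at r u≡ v≡ (index-of-foot separated)
      where
      index-of-foot : FeetSeparated L₁ ⊎ FeetSeparated L₂ → r ≡ t
      index-of-foot (inj₁ sep₁) = sep₁ t r u u∈ u≡
      index-of-foot (inj₂ sep₂) = sep₂ t r v v∈ v≡
      at : ∀ r → u ≡ f₁ r → v ≡ f₂ r → r ≡ t → u ≡ f₁ t × v ≡ f₂ t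
      at r u≡ v≡ refl = u≡ , v≡

    route-chordless : ∀ t → Chordless (h₁ t ∷ route t)
    route-chordless t with reverse-∷ (h₂ t) (t₂ t)
    ... | ys , rev≡ , _ =
      subst (λ l → Chordless (h₁ t ∷ t₁ t ++ l)) (sym rev≡)
        (chordless-++ (h₁ t) (t₁ t) (f₂ t) ys (c₁ t) (subst Chordless rev≡ (chordless-reverse (leg₂ t) (c₂ t)))
          (attached t) joined)
      where
      joined : JoinedOnlyAt (leg₁ t) (f₂ t ∷ ys) (f₁ t) (f₂ t)
      joined u v u∈ v∈ = disjoint t t u v u∈ (reverse-∷-⊆ rev≡ v∈) , edge-same-leg t u v u∈ (reverse-∷-⊆ rev≡ v∈)

    route-last : ∀ t → lastOf (h₁ t) (route t) ≡ h₂ t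
    route-last t with reverse-∷ (h₂ t) (t₂ t)
    ... | ys , rev≡ , last≡ = trans (lastOf-++ (h₁ t) (t₁ t) (reverse (leg₂ t))) (trans (cong (lastOf (f₁ t)) rev≡) last≡)

    route-⊆ : ∀ t z → z ∈ₗ h₁ t ∷ route t → z ∈ₗ leg₁ t ⊎ z ∈ₗ leg₂ t
    route-⊆ t z (here z≡)  = inj₁ (here z≡)
    route-⊆ t z (there z∈) with ∈-++⁻ (t₁ t) z∈
    ... | inj₁ z∈₁ = inj₁ (there z∈₁)
    ... | inj₂ z∈₂ = inj₂ (reverse⁻ z∈₂)

    length-++-leg₂ : ∀ t xs → 1 ≤ length (xs ++ reverse (leg₂ t))
    length-++-leg₂ t xs rewrite length-++ xs {reverse (leg₂ t)} | length-reverse (leg₂ t) =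
      ≤-trans (s≤s z≤n) (m≤n+m (suc (length (t₂ t))) (length xs))

    len≥1 : ∀ t → 1 ≤ len t
    len≥1 t = length-++-leg₂ t (t₁ t)

    len≥2 : ∀ t → t₁ t ≢ [] → 2 ≤ len t
    len≥2 t nonempty with t₁ t
    ... | []     = ⊥-elim (nonempty refl)
    ... | _ ∷ xs = s≤s (length-++-leg₂ t xs)

    module _ (t : Fin 3) where

      isPath : IsPath G (len t) (vertexAt t)
      isPath = chordless⇒IsPath (h₁ t) (route t) (route-chordless t)

      vertexAt-last : vertexAt t (fromℕ (len t)) ≡ h₂ t
      vertexAt-last = trans (lookup-last (h₁ t) (route t)) (route-last t)

      vertexAt-∈ : ∀ i → vertexAt t i ∈ₗ leg₁ t ⊎ vertexAt t i ∈ₗ leg₂ t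
      vertexAt-∈ i = route-⊆ t (vertexAt t i) (∈-lookup i)

      at-head₁ : ∀ i → vertexAt t i ≡ h₁ t → i ≡ zero
      at-head₁ i e = lookup-injective (h₁ t ∷ route t) (route-chordless t) i zero e

      at-head₂ : ∀ i → vertexAt t i ≡ h₂ t → i ≡ fromℕ (len t)
      at-head₂ i e = lookup-injective (h₁ t ∷ route t) (route-chordless t) i (fromℕ (len t)) (trans e (sym vertexAt-last))

    -- A vertex of the first tail of one route and the second leg of another cannot be adjacent:
    -- the edge would join feet of one index r, putting a foot of r in a leg of another index.
    theta : IsClaw h₁ t₁ → IsClaw h₂ t₂ → (∀ t → t₁ t ≢ []) → HasTheta G
    theta claw₁@(_ , apart₁) claw₂@(same₂ , apart₂) nonempty =
      h₁ zero , h₂ zero , len , vertexAt , isPath , (λ t → len≥2 t (nonempty t)) , (λ t → proj₁ claw₁ t zero) ,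
      (λ t → trans (vertexAt-last t) (same₂ t zero)) ,
      (λ s t s≢t i j i° j° → proj₁ (apartInner s t s≢t i j i° j°)) ,
      (λ s t s≢t i j i° j° → proj₂ (apartInner s t s≢t i j i° j°))
      where
      inner : ∀ t i → Interior G (len t) i → vertexAt t i ∈ₗ t₁ t ⊎ vertexAt t i ∈ₗ t₂ t
      inner t i i° with vertexAt-∈ t i
      ... | inj₁ (here e)   = ⊥-elim (interior≢zero i i° (at-head₁ t i e))
      ... | inj₁ (there x∈) = inj₁ x∈
      ... | inj₂ (here e)   = ⊥-elim (interior≢last i i° (at-head₂ t i e))
      ... | inj₂ (there x∈) = inj₂ x∈
      mixed : ∀ s t → s ≢ t → ∀ x y → x ∈ₗ t₁ s → y ∈ₗ t₂ t → Apart x y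
      mixed s t s≢t x y x∈ y∈ =
        disjoint s t x y (there x∈) (there y∈) , λ xy → no-edge (edge s t x y (there x∈) (there y∈) xy)
        where
        no-edge : (∃ λ r → x ≡ f₁ r × y ≡ f₂ r) → ⊥
        no-edge (r , x≡ , y≡) with claw⇒feetSeparated L₁ claw₁ nonempty s r x (there x∈) x≡
        ... | refl = claw-foot∉tail L₂ claw₂ s t s≢t (subst (_∈ₗ t₂ t) y≡ y∈)
      apart : ∀ s t → s ≢ t → ∀ x y → x ∈ₗ t₁ s ⊎ x ∈ₗ t₂ s → y ∈ₗ t₁ t ⊎ y ∈ₗ t₂ t → Apart x y
      apart s t s≢t x y (inj₁ x∈) (inj₁ y∈) = apart₁ s t s≢t x y x∈ y∈
      apart s t s≢t x y (inj₂ x∈) (inj₂ y∈) = apart₂ s t s≢t x y x∈ y∈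
      apart s t s≢t x y (inj₁ x∈) (inj₂ y∈) = mixed s t s≢t x y x∈ y∈
      apart s t s≢t x y (inj₂ x∈) (inj₁ y∈) = Apart-sym (mixed t s (λ t≡s → s≢t (sym t≡s)) y x y∈ x∈)
      apartInner : ∀ s t → s ≢ t → ∀ i j → Interior G (len s) i → Interior G (len t) j →
        Apart (vertexAt s i) (vertexAt t j)
      apartInner s t s≢t i j i° j° = apart s t s≢t _ _ (inner s i i°) (inner t j j°)

    pyramid : IsClaw h₁ t₁ → IsTriangle h₂ t₂ → (∃₂ λ s t → s ≢ t × t₁ s ≢ [] × t₁ t ≢ []) → HasPyramid G
    pyramid claw₁@(same₁ , apart₁) triangle₂@(adjacent₂ , joined₂) (s₀ , t₀ , s₀≢t₀ , nonempty-s₀ , nonempty-t₀) =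
      h₁ zero , len , vertexAt , isPath , len≥1 , (s₀ , t₀ , s₀≢t₀ , len≥2 s₀ nonempty-s₀ , len≥2 t₀ nonempty-t₀) ,
      (λ t → same₁ t zero) , (λ s t s≢t i j i≢0 j≢0 → proj₁ (crossAt s t s≢t i j i≢0 j≢0)) , edges
      where
      nonApex : ∀ t i → i ≢ zero → vertexAt t i ∈ₗ t₁ t ⊎ vertexAt t i ∈ₗ leg₂ t
      nonApex t i i≢0 with vertexAt-∈ t i
      ... | inj₁ (here e)   = ⊥-elim (i≢0 (at-head₁ t i e))
      ... | inj₁ (there x∈) = inj₁ x∈
      ... | inj₂ x∈         = inj₂ x∈
      mixed : ∀ s t → s ≢ t → ∀ x y → x ∈ₗ t₁ s → y ∈ₗ leg₂ t → Apart x y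
      mixed s t s≢t x y x∈ y∈ = disjoint s t x y (there x∈) y∈ , λ xy → no-edge (edge s t x y (there x∈) y∈ xy)
        where
        no-edge : (∃ λ r → x ≡ f₁ r × y ≡ f₂ r) → ⊥
        no-edge (r , x≡ , y≡) with triangle⇒feetSeparated L₂ triangle₂ t r y y∈ y≡
        ... | refl = claw-foot∉tail L₁ claw₁ t s (λ t≡s → s≢t (sym t≡s)) (subst (_∈ₗ t₁ s) x≡ x∈)
      Joined : Fin 3 → Fin 3 → Vertex → Vertex → Set
      Joined s t x y = x ≢ y × (E x y → x ≡ h₂ s × y ≡ h₂ t)
      apart⇒joined : ∀ {s t x y} → Apart x y → Joined s t x y
      apart⇒joined (x≢y , ¬xy) = x≢y , λ xy → ⊥-elim (¬xy xy)
      cross : ∀ s t → s ≢ t → ∀ x y → x ∈ₗ t₁ s ⊎ x ∈ₗ leg₂ s → y ∈ₗ t₁ t ⊎ y ∈ₗ leg₂ t → Joined s t x y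
      cross s t s≢t x y (inj₁ x∈) (inj₁ y∈) = apart⇒joined (apart₁ s t s≢t x y x∈ y∈)
      cross s t s≢t x y (inj₂ x∈) (inj₂ y∈) = joined₂ s t s≢t x y x∈ y∈
      cross s t s≢t x y (inj₁ x∈) (inj₂ y∈) = apart⇒joined (mixed s t s≢t x y x∈ y∈)
      cross s t s≢t x y (inj₂ x∈) (inj₁ y∈) = apart⇒joined (Apart-sym (mixed t s (λ t≡s → s≢t (sym t≡s)) y x y∈ x∈))
      crossAt : ∀ s t → s ≢ t → ∀ i j → i ≢ zero → j ≢ zero → Joined s t (vertexAt s i) (vertexAt t j)
      crossAt s t s≢t i j i≢0 j≢0 = cross s t s≢t _ _ (nonApex s i i≢0) (nonApex t j j≢0)
      edges : ∀ s t → s ≢ t → ∀ i j → i ≢ zero → j ≢ zero →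
        (E (vertexAt s i) (vertexAt t j) → i ≡ fromℕ (len s) × j ≡ fromℕ (len t)) ×
        (i ≡ fromℕ (len s) × j ≡ fromℕ (len t) → E (vertexAt s i) (vertexAt t j))
      edges s t s≢t i j i≢0 j≢0 =
        (λ e → let i≡ , j≡ = proj₂ (crossAt s t s≢t i j i≢0 j≢0) e in at-head₂ s i i≡ , at-head₂ t j j≡) ,
        λ { (refl , refl) → subst₂ E (sym (vertexAt-last s)) (sym (vertexAt-last t)) (adjacent₂ s t s≢t) }

    prism : IsTriangle h₁ t₁ → IsTriangle h₂ t₂ → HasPrism G
    prism triangle₁@(adjacent₁ , joined₁) triangle₂@(adjacent₂ , joined₂) =
      len , vertexAt , isPath , inj₁ len≥1 , (λ s t s≢t i j → proj₁ (crossAt s t s≢t i j)) , edges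
      where
      Ends : Fin 3 → Fin 3 → Vertex → Vertex → Set
      Ends s t x y = (x ≡ h₁ s × y ≡ h₁ t) ⊎ (x ≡ h₂ s × y ≡ h₂ t)
      mixed : ∀ s t → s ≢ t → ∀ x y → x ∈ₗ leg₁ s → y ∈ₗ leg₂ t → Apart x y
      mixed s t s≢t x y x∈ y∈ = disjoint s t x y x∈ y∈ , λ xy → no-edge (edge s t x y x∈ y∈ xy)
        where
        no-edge : (∃ λ r → x ≡ f₁ r × y ≡ f₂ r) → ⊥
        no-edge (r , x≡ , y≡) = s≢t (trans (sym (triangle⇒feetSeparated L₁ triangle₁ s r x x∈ x≡))
                                           (triangle⇒feetSeparated L₂ triangle₂ t r y y∈ y≡))
      apart⇒ends : ∀ {s t x y} → Apart x y → x ≢ y × (E x y → Ends s t x y)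
      apart⇒ends (x≢y , ¬xy) = x≢y , λ xy → ⊥-elim (¬xy xy)
      cross : ∀ s t → s ≢ t → ∀ x y → x ∈ₗ leg₁ s ⊎ x ∈ₗ leg₂ s → y ∈ₗ leg₁ t ⊎ y ∈ₗ leg₂ t →
        x ≢ y × (E x y → Ends s t x y)
      cross s t s≢t x y (inj₁ x∈) (inj₁ y∈) with joined₁ s t s≢t x y x∈ y∈
      ... | x≢y , ends = x≢y , λ xy → inj₁ (ends xy)
      cross s t s≢t x y (inj₂ x∈) (inj₂ y∈) with joined₂ s t s≢t x y x∈ y∈
      ... | x≢y , ends = x≢y , λ xy → inj₂ (ends xy)
      cross s t s≢t x y (inj₁ x∈) (inj₂ y∈) = apart⇒ends (mixed s t s≢t x y x∈ y∈)
      cross s t s≢t x y (inj₂ x∈) (inj₁ y∈) = apart⇒ends (Apart-sym (mixed t s (λ t≡s → s≢t (sym t≡s)) y x y∈ x∈))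
      crossAt : ∀ s t → s ≢ t → ∀ i j →
        vertexAt s i ≢ vertexAt t j × (E (vertexAt s i) (vertexAt t j) → Ends s t (vertexAt s i) (vertexAt t j))
      crossAt s t s≢t i j = cross s t s≢t _ _ (vertexAt-∈ s i) (vertexAt-∈ t j)
      Ix : ∀ {ks kt} → Fin (suc ks) → Fin (suc kt) → Set
      Ix {ks} {kt} i j = (i ≡ zero × j ≡ zero) ⊎ (i ≡ fromℕ ks × j ≡ fromℕ kt)
      edges : ∀ s t → s ≢ t → ∀ i j →
        (E (vertexAt s i) (vertexAt t j) → Ix i j) × (Ix i j → E (vertexAt s i) (vertexAt t j))
      edges s t s≢t i j = (λ e → toIx (proj₂ (crossAt s t s≢t i j) e)) , fromIx
        where
        toIx : Ends s t (vertexAt s i) (vertexAt t j) → Ix i j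
        toIx (inj₁ (i≡ , j≡)) = inj₁ (at-head₁ s i i≡ , at-head₁ t j j≡)
        toIx (inj₂ (i≡ , j≡)) = inj₂ (at-head₂ s i i≡ , at-head₂ t j j≡)
        fromIx : Ix i j → E (vertexAt s i) (vertexAt t j)
        fromIx (inj₁ (refl , refl)) = adjacent₁ s t s≢t
        fromIx (inj₂ (refl , refl)) = subst₂ E (sym (vertexAt-last s)) (sym (vertexAt-last t)) (adjacent₂ s t s≢t)

  SeesSet : VSet G → Vertex → Set
  SeesSet T u = VSees G u T

  sees? : ∀ T → Decidable (SeesSet T)
  sees? T u = anyFin? (λ v → (v ∈? T) ×-dec E-dec u v)

  pathBetween⇒typePathCentered : ∀ {A X Y Z} (p : PathBetween (SeesSet X) (SeesSet Z)) →
    (∀ z → z ∈ₗ PathBetween.vertices p → z ∈ A) → Any (SeesSet Y) (PathBetween.vertices p) →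
    TypePathCentered G A X Y Z
  pathBetween⇒typePathCentered (pathBetween x xs c x-X end-Z X⇒x Z⇒end) within through =
    length xs , lookup (x ∷ xs) , chordless⇒IsPath x xs c , (λ i → within _ (∈-lookup i)) , x-X ,
    subst (SeesSet _) (sym (lookup-last x xs)) end-Z , (Any.index through , lookup-index through) ,
    (λ i i≢0 v v∈ e → i≢0 (lookup-injective (x ∷ xs) c i zero (X⇒x _ (∈-lookup i) (v , v∈ , e)))) ,
    (λ i i≢last v v∈ e → i≢last (lookup-injective (x ∷ xs) c i (fromℕ (length xs))
                                   (trans (Z⇒end _ (∈-lookup i) (v , v∈ , e)) (sym (lookup-last x xs)))))

  module _ {A X Y Z : VSet G} where
    private
      N : Fin 3 → Vertex → Set
      N t = SeesSet (cases₃ X Y Z t)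

    centred : ∀ α γ → α ≢ γ → (p : PathBetween (N α) (N γ)) → (∀ z → z ∈ₗ PathBetween.vertices p → z ∈ A) →
      Any (N (third α γ)) (PathBetween.vertices p) → TypePath G A X Y Z
    centred zero zero α≢γ _ _ _ = ⊥-elim (α≢γ refl)
    centred zero one  _   p within through = inj₂ (inj₂ (pathBetween⇒typePathCentered p within through))
    centred zero two  _   p within through = inj₁ (pathBetween⇒typePathCentered p within through)
    centred one  zero α≢γ p within through with reversePath p
    ... | q , q⊆p , p⊆q = centred zero one (λ ()) q (λ z z∈ → within z (q⊆p z∈)) (Any-resp-⊆ p⊆q through)
    centred one  one  α≢γ _ _ _ = ⊥-elim (α≢γ refl)
    centred one  two  _   p within through = inj₂ (inj₁ (pathBetween⇒typePathCentered p within through))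
    centred two  zero α≢γ p within through with reversePath p
    ... | q , q⊆p , p⊆q = centred zero two (λ ()) q (λ z z∈ → within z (q⊆p z∈)) (Any-resp-⊆ p⊆q through)
    centred two  one  α≢γ p within through with reversePath p
    ... | q , q⊆p , p⊆q = centred one two (λ ()) q (λ z z∈ → within z (q⊆p z∈)) (Any-resp-⊆ p⊆q through)
    centred two  two  α≢γ _ _ _ = ⊥-elim (α≢γ refl)

    threaded⇒typePath : ThreadedPath (_∈ A) N → TypePath G A X Y Z
    threaded⇒typePath (threaded α γ α≢γ p within through) = centred α γ α≢γ p within through

  module _ {C : Vertex → Set} {N : Fin 3 → Vertex → Set}
           (N-unique : ∀ t y y′ → C y → C y′ → N t y → N t y′ → y ≡ y′) where

    -- The path is split at its N β-vertex z, which is the centre of a claw with an empty leg β.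
    threaded⇒spider : ThreadedPath C N → Spider C N
    threaded⇒spider (threaded α γ α≢γ p within through) with find through
    ... | z , z∈ , nz with ∈-∃++ z∈
    ... | pre , post , eq =
      spider (legs (λ _ → z) tail chordless′ (inj₁ ((λ _ _ → refl) , apart))) (λ t w w∈ → within w (leg⊆ t w∈))
        foot-N N⇒foot
      where
      open PathBetween p
      cP : Chordless (pre ++ z ∷ post)
      cP = subst Chordless eq chordless
      tailFor : ∀ {t} → Role α γ t → List Vertex
      tailFor (isα _) = reverse pre
      tailFor (isγ _) = post
      tailFor (isβ _) = []
      tail : Fin 3 → List Vertex
      tail t = tailFor (role α γ α≢γ t)
      chordless′ : ∀ t → Chordless (z ∷ tail t)
      chordless′ t with role α γ α≢γ t
      ... | isα _ = chordless-reversed-prefix pre z post cP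
      ... | isγ _ = chordless-suffix pre (z ∷ post) cP
      ... | isβ _ = tt , tt
      apart : ∀ s t → s ≢ t → ApartLists (tail s) (tail t)
      apart s t s≢t x y x∈ y∈ with role α γ α≢γ s | role α γ α≢γ t
      ... | isα refl | isα refl = ⊥-elim (s≢t refl)
      ... | isγ refl | isγ refl = ⊥-elim (s≢t refl)
      ... | isα _    | isγ _    = chordless-apart pre z post cP x y (reverse⁻ x∈) y∈
      ... | isγ _    | isα _    = Apart-sym (chordless-apart pre z post cP y x (reverse⁻ y∈) x∈)
      leg⊆ : ∀ t → z ∷ tail t ⊆ vertices
      leg⊆ t w∈ with role α γ α≢γ t
      ... | isα _ = split-prefix-⊆ pre z post eq w∈
      ... | isγ _ = split-suffix-⊆ pre z post eq w∈
      leg⊆ t (here refl) | isβ _ = z∈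
      foot-N : ∀ t → N t (lastOf z (tail t))
      foot-N t with role α γ α≢γ t
      ... | isα refl = subst (N α) (sym (lastOf-reversed-prefix pre z post eq)) start-P
      ... | isγ refl = subst (N γ) (lastOf-split pre z post eq) end-Q
      ... | isβ refl = nz
      N⇒foot : ∀ t s w → w ∈ₗ z ∷ tail s → N t w → w ≡ lastOf z (tail t)
      N⇒foot t s w w∈ nw with role α γ α≢γ t
      ... | isα refl = trans (P⇒start w (leg⊆ s w∈) nw) (sym (lastOf-reversed-prefix pre z post eq))
      ... | isγ refl = trans (Q⇒end w (leg⊆ s w∈) nw) (lastOf-split pre z post eq)
      ... | isβ refl = N-unique (third α γ) w z (within w (leg⊆ s w∈)) (within z z∈) nw nz

  module _ {C : Vertex → Set} {N : Fin 3 → Vertex → Set} (S : Spider C N) where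
    open Spider S

    Exclusive : Set
    Exclusive = ∀ s t → s ≢ t → ∀ v → C v → N s v → N t v → ⊥

    -- The centre of a claw with two empty legs s and t would satisfy both N s and N t.
    claw-emptyTails : IsClaw head tail → Exclusive → ∀ s t → s ≢ t → tail s ≡ [] → tail t ≡ [] → ⊥
    claw-emptyTails (same , _) exclusive s t s≢t es et =
      exclusive s t s≢t (head s) (within s (head s) (here refl)) (centre-N s es) (subst (N t) (same t s) (centre-N t et))
      where
      centre-N : ∀ t → tail t ≡ [] → N t (head t)
      centre-N t e = subst (λ l → N t (lastOf (head t) l)) e (foot-N t)

    claw-twoNonemptyTails : IsClaw head tail → Exclusive → ∃₂ λ s t → s ≢ t × tail s ≢ [] × tail t ≢ []
    claw-twoNonemptyTails claw exclusive with ≟[] (tail zero) | ≟[] (tail one) | ≟[] (tail two)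
    ... | _      | no ¬e₁ | no ¬e₂ = one , two , (λ ()) , ¬e₁ , ¬e₂
    ... | no ¬e₀ | yes _  | no ¬e₂ = zero , two , (λ ()) , ¬e₀ , ¬e₂
    ... | no ¬e₀ | no ¬e₁ | yes _  = zero , one , (λ ()) , ¬e₀ , ¬e₁
    ... | yes e₀ | yes e₁ | _      = ⊥-elim (claw-emptyTails claw exclusive zero one (λ ()) e₀ e₁)
    ... | yes e₀ | no _   | yes e₂ = ⊥-elim (claw-emptyTails claw exclusive zero two (λ ()) e₀ e₂)
    ... | no _   | yes e₁ | yes e₂ = ⊥-elim (claw-emptyTails claw exclusive one two (λ ()) e₁ e₂)

  Connector : VSet G → Vertex → VSet G → Set
  Connector B a T = Σ (PathBetween (λ z → E z a) (SeesSet B)) λ p → ∀ z → z ∈ₗ PathBetween.vertices p → z ∈ T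

  opaque
    connector : ∀ B T a → Connected G T → VSees G a T → Sees G B T → Connector B a T
    connector B T a T-connected (v , v∈T , av) (b , w , b∈B , w∈T , bw)
      with walkWithin⇒chordless (fromWalkIn (T-connected v w v∈T w∈T))
    ... | ps , c , last≡ , within
      with trim (λ z → E-dec z a) (sees? B) v ps c (E-sym av) (subst (SeesSet B) (sym last≡) (b , b∈B , E-sym bw))
    ... | p , p⊆ = p , λ z z∈ → within z (p⊆ z∈)

  module OneSide (no3PC : ¬ Has3PC G) (A B : VSet G) (S : Fin 3 → VSet G)
    (A-B : Disjoint G A B) (A-S : ∀ t → Disjoint G A (S t)) (S-S : ∀ s t → s ≢ t → Disjoint G (S s) (S t))
    (A-connected : Connected G A) (B-connected : Connected G B) (S-connected : ∀ t → Connected G (S t))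
    (A-B-anticomplete : Anticomplete G A B) (A-sees : ∀ t → Sees G A (S t)) (B-sees : ∀ t → Sees G B (S t))
    where

    NA : Fin 3 → Vertex → Set
    NA t = SeesSet (S t)

    module _ (SA : ProperSpider (_∈ A) NA) where
      open Spider (proj₁ SA) using () renaming
        (body to bodyA; head to hA; tail to tA; leg to legA; foot to a; within to within-A; foot-N to a-N;
         N⇒foot to NA⇒a; shape to shapeA)

      a-separated : FeetSeparated bodyA
      a-separated with shapeA
      ... | inj₁ claw     = claw⇒feetSeparated bodyA claw (proj₂ SA claw)
      ... | inj₂ triangle = triangle⇒feetSeparated bodyA triangle

      connectorAt : ∀ t → Connector B (a t) (S t)
      connectorAt t = connector B (S t) (a t) (S-connected t) (a-N t) (B-sees t)

      c : Fin 3 → Vertex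
      c t = PathBetween.start (proj₁ (connectorAt t))

      CB : Vertex → Set
      CB v = v ∈ B ⊎ ∃ λ t → v ∈ₗ PathBetween.vertices (proj₁ (connectorAt t))

      NB : Fin 3 → Vertex → Set
      NB t y = E y (a t)

      a∈A : ∀ t → a t ∈ A
      a∈A t = within-A t (a t) (lastOf-∈ (hA t) (tA t))

      NB⇒c : ∀ t y → CB y → NB t y → y ≡ c t
      NB⇒c t y (inj₁ y∈B)     ya = ⊥-elim (A-B-anticomplete (a t) y (a∈A t) y∈B (E-sym ya))
      NB⇒c t y (inj₂ (r , y∈)) ya with a-separated t r (a t) (lastOf-∈ (hA t) (tA t))
                                     (NA⇒a r t (a t) (lastOf-∈ (hA t) (tA t)) (y , proj₂ (connectorAt r) y y∈ , E-sym ya))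
      ... | refl = PathBetween.P⇒start (proj₁ (connectorAt t)) y y∈ ya

      b₀ : Vertex
      b₀ = proj₁ (B-sees zero)

      inB : ∀ u → u ∈ B → WalkWithin CB u b₀
      inB u u∈B =
        walkWithin-mono (λ _ → inj₁) (fromWalkIn (B-connected u b₀ u∈B (proj₁ (proj₂ (proj₂ (B-sees zero))))))

      alongConnector : ∀ t u → u ∈ₗ PathBetween.vertices (proj₁ (connectorAt t)) → WalkWithin CB u b₀
      alongConnector t u u∈ with ∈-∃++ u∈
      ... | pre , post , eq =
        walkWithin-++ (subst (WalkWithin CB u) (sym (lastOf-split pre u post eq)) along)
          (step (inj₂ (t , lastOf-∈ start rest)) (proj₂ (proj₂ end-Q)) (inB _ (proj₁ (proj₂ end-Q))))
        where
        open PathBetween (proj₁ (connectorAt t))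
        along : WalkWithin CB u (lastOf u post)
        along = walk⇒walkWithin u post
                  (chordless⇒walk u post (chordless-suffix pre (u ∷ post) (subst Chordless eq chordless)))
                  (λ z z∈ → inj₂ (t , split-suffix-⊆ pre u post eq z∈))

      toB : ∀ u → CB u → WalkWithin CB u b₀
      toB u (inj₁ u∈B)       = inB u u∈B
      toB u (inj₂ (t , u∈)) = alongConnector t u u∈

      CB-connected : ConnectedWithin CB
      CB-connected u v cu cv = walkWithin-++ (toB u cu) (walkWithin-reverse (toB v cv))

      c∈CB : ∀ t → CB (c t)
      c∈CB t = inj₂ (t , here refl)

      spiderB : Spider CB NB
      spiderB with tripod (λ t y → E-dec y (a t)) CB-connected
                          (λ t → c t , c∈CB t , PathBetween.start-P (proj₁ (connectorAt t)))
      ... | inj₁ threadedB =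
        threaded⇒spider (λ t y y′ cy cy′ ny ny′ → trans (NB⇒c t y cy ny) (sym (NB⇒c t y′ cy′ ny′))) threadedB
      ... | inj₂ (SB , _) = SB

      open Spider spiderB using () renaming
        (body to bodyB; leg to legB; foot to b; within to within-B; foot-N to b-N; N⇒foot to NB⇒b; shape to shapeB)

      c∈S : ∀ t → c t ∈ S t
      c∈S t = proj₂ (connectorAt t) (c t) (here refl)

      disjoint : ∀ s t x y → x ∈ₗ legA s → y ∈ₗ legB t → x ≢ y
      disjoint s t x y x∈ y∈ x≡y with within-B t y y∈
      ... | inj₁ y∈B      = A-B x (within-A s x x∈) (subst (_∈ B) (sym x≡y) y∈B)
      ... | inj₂ (r , y∈Cr) =
        A-S r x (within-A s x x∈) (subst (_∈ S r) (sym x≡y) (proj₂ (connectorAt r) y y∈Cr))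

      edge : ∀ s t x y → x ∈ₗ legA s → y ∈ₗ legB t → E x y → ∃ λ r → x ≡ a r × y ≡ b r
      edge s t x y x∈ y∈ xy with within-B t y y∈
      ... | inj₁ y∈B      = ⊥-elim (A-B-anticomplete x y (within-A s x x∈) y∈B xy)
      ... | inj₂ (r , y∈Cr) = r , x≡a , NB⇒b r t y y∈ (subst (E y) x≡a (E-sym xy))
        where
        x≡a : x ≡ a r
        x≡a = NA⇒a r s x x∈ (y , proj₂ (connectorAt r) y y∈Cr , xy)

      exclusiveB : Exclusive spiderB
      exclusiveB s t s≢t v cv nsv ntv =
        S-S s t s≢t (c s) (c∈S s) (subst (_∈ S t) (trans (sym (NB⇒c t v cv ntv)) (NB⇒c s v cv nsv)) (c∈S t))

      has3PC : Has3PC G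
      has3PC with shapeA | shapeB
      ... | inj₁ clawA     | inj₁ clawB     =
        inj₁ (Glue.theta bodyA bodyB disjoint edge (λ t → E-sym (b-N t)) (inj₁ a-separated) clawA clawB (proj₂ SA clawA))
      ... | inj₁ clawA     | inj₂ triangleB =
        inj₂ (inj₂ (Glue.pyramid bodyA bodyB disjoint edge (λ t → E-sym (b-N t)) (inj₁ a-separated) clawA triangleB
          (zero , one , (λ ()) , proj₂ SA clawA zero , proj₂ SA clawA one)))
      ... | inj₂ triangleA | inj₁ clawB     =
        inj₂ (inj₂ (Glue.pyramid bodyB bodyA (λ s t y x y∈ x∈ y≡x → disjoint t s x y x∈ y∈ (sym y≡x))
          (λ s t y x y∈ x∈ yx → let r , x≡ , y≡ = edge t s x y x∈ y∈ (E-sym yx) in r , y≡ , x≡)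
          b-N (inj₂ a-separated) clawB triangleA (claw-twoNonemptyTails spiderB clawB exclusiveB)))
      ... | inj₂ triangleA | inj₂ triangleB =
        inj₂ (inj₁ (Glue.prism bodyA bodyB disjoint edge (λ t → E-sym (b-N t)) (inj₁ a-separated) triangleA triangleB))

    threadedInA : ThreadedPath (_∈ A) NA
    threadedInA with tripod (λ t → sees? (S t)) (λ u v u∈ v∈ → fromWalkIn (A-connected u v u∈ v∈))
                            (λ t → let u , v , u∈A , v∈S , uv = A-sees t in u , u∈A , v , v∈S , uv)
    ... | inj₁ tp = tp
    ... | inj₂ SA = ⊥-elim (no3PC (has3PC SA))

lemma2p2 : (G : Graph) → ¬ Has3PC G →
    (A B X Y Z : VSet G) →
    Disjoint G A B → Disjoint G A X → Disjoint G A Y → Disjoint G A Z →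
    Disjoint G B X → Disjoint G B Y → Disjoint G B Z →
    Disjoint G X Y → Disjoint G X Z → Disjoint G Y Z →
    Connected G A → Connected G B → Connected G X → Connected G Y → Connected G Z →
    Anticomplete G X Y → Anticomplete G X Z → Anticomplete G Y Z →
    Anticomplete G A B →
    Sees G A X → Sees G A Y → Sees G A Z →
    Sees G B X → Sees G B Y → Sees G B Z →
    TypePath G A X Y Z × TypePath G B X Y Z
lemma2p2 G no3PC A B X Y Z A-B A-X A-Y A-Z B-X B-Y B-Z X-Y X-Z Y-Z A-conn B-conn X-conn Y-conn Z-conn
         _ _ _ A-B-anti A-X-sees A-Y-sees A-Z-sees B-X-sees B-Y-sees B-Z-sees =
  threaded⇒typePath G (OneSide.threadedInA G no3PC A B S A-B (cases₃ A-X A-Y A-Z) S-S A-conn B-conn S-conn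
                         A-B-anti (cases₃ A-X-sees A-Y-sees A-Z-sees) (cases₃ B-X-sees B-Y-sees B-Z-sees)) ,
  threaded⇒typePath G (OneSide.threadedInA G no3PC B A S B-A (cases₃ B-X B-Y B-Z) S-S B-conn A-conn S-conn
                         B-A-anti (cases₃ B-X-sees B-Y-sees B-Z-sees) (cases₃ A-X-sees A-Y-sees A-Z-sees))
  where
  S : Fin 3 → VSet G
  S = cases₃ X Y Z
  S-S : ∀ s t → s ≢ t → Disjoint G (S s) (S t)
  S-S = onDistinctPairs (λ s t → Disjoint G (S s) (S t)) (λ disj v v∈t v∈s → disj v v∈s v∈t) X-Y X-Z Y-Z
  S-conn : ∀ t → Connected G (S t)
  S-conn = cases₃ X-conn Y-conn Z-conn
  B-A : Disjoint G B A
  B-A v v∈B v∈A = A-B v v∈A v∈B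
  B-A-anti : Anticomplete G B A
  B-A-anti u v u∈B v∈A uv = A-B-anti v u v∈A u∈B (Graph.E-sym G uv)
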